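{- Let $G$ be a minimally $\frac12$-tough series–parallel graph containing the substructure $R_{2,1}$, where the $R_2$ part has terminals $s_1,t_1$ and the edge part is $t_1t_2$. Then the root of this $R_{2,1}$ substructure is the root of $T_G$, and $s_1$ is a cut-vertex of $G$.
   Context: All graphs are finite and undirected; parallel edges allowed. For a graph $H$, $c(H)$ denotes its number of components. A set $S\subseteq V(G)$ is a cutset if $c(G-S)>1$. $G$ is $t$-tough if $|S|\ge t\cdot c(G-S)$ for every cutset $S$; $\tau(G)$ is the largest such $t$, with $\tau(K_n)=\infty$. $G$ is minimally $t$-tough if $\tau(G)=t$ and $\tau(G-e)<t$ for every edge $e$. A series–parallel graph $G(s,t)$ with terminals $s,t$ is either a single edge $st$, or is obtained from series–parallel graphs $G_1(s_1,t_1),\dots,G_k(s_k,t_k)$, $k\ge 2$, by a series join (identify $t_i$ with $s_{i+1}$, set $s=s_1$, $t=t_k$) or a parallel join (identify all $s_i$ into $s$ and all $t_i$ into $t$). The construction gives a rooted ordered tree $T_G$ (sp-tree): leaves are edges, internal nodes are series or parallel joins (children ordered as joined), with series and parallel nodes alternating along root-to-leaf paths. A substructure of $T_G$ rooted at a node $x$ consists of $x$ together with some of its children (consecutive ones if $x$ is a series node) and the complete subtrees below those children; only the root of a substructure may have further children not in it. $P_2$ is a series node with exactly two edge children. $R_2$ is a parallel node with exactly two children, each a $P_2$ (a $4$-cycle $s_1v_1t_1v_2$ with terminals $s_1,t_1$). $R_{2,1}$ is the substructure consisting of a series node having, as two consecutive children in this order, an $R_2$ (terminals $s_1,t_1$)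 and a single edge $t_1t_2$. $G$ contains $R_{2,1}$ if $T_G$ has a substructure of this form. -}

module Defs where

open import Data.Nat using (ℕ; zero; suc; _+_) renaming (_<_ to _<ℕ_; _≤_ to _≤ℕ_)
open import Data.Fin using (Fin; zero; suc; _↑ˡ_; _↑ʳ_)
open import Data.Fin.Subset using (Subset; _∉_; ∣_∣; ⁅_⁆) renaming (⊥ to ∅)
open import Data.List using (List; []; _∷_; _++_; length; lookup; map; removeAt)
open import Data.List.Membership.Propositional using (_∈_)
open import Data.Product using (Σ; _×_; _,_; ∃)
open import Data.Sum using (_⊎_)
open import Data.Unit using (⊤)
open import Data.Integer using (+_)
open import Data.Rational using (ℚ; _/_; _*_; _≤_; _<_)
open import Relation.Nullary using (¬_)
open import Relation.Binary.PropositionalEquality using (_≡_; _≢_; subst; sym)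
open import Function using (id; _∘_)

-- Finite undirected multigraphs: vertex set Fin n, edge multiset given
-- as a list of (unordered, i.e. orientation irrelevant) vertex pairs.

record MGraph : Set where
  field
    n     : ℕ
    edges : List (Fin n × Fin n)
open MGraph public

module _ (G : MGraph) where

  Adj : Fin (n G) → Fin (n G) → Set
  Adj u v = ((u , v) ∈ edges G) ⊎ ((v , u) ∈ edges G)

  data Conn (S : Subset (n G)) : Fin (n G) → Fin (n G) → Set where
    conn-refl : ∀ {u} → u ∉ S → Conn S u u
    conn-step : ∀ {u v w} → Conn S u v → Adj v w → w ∉ S → Conn S u w

  -- c(G - S) = k : there are k representatives, one in each component of G - S
  Components : Subset (n G) → ℕ → Set
  Components S k =
    Σ (Fin k → Fin (n G)) λ rep →
      (∀ i → rep i ∉ S)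
      × (∀ i j → Conn S (rep i) (rep j) → i ≡ j)
      × (∀ v → v ∉ S → Σ (Fin k) λ i → Conn S v (rep i))

  IsTough : ℚ → Set
  IsTough t = ∀ (S : Subset (n G)) (k : ℕ) → Components S k → 1 <ℕ k →
              t * ((+ k) / 1) ≤ (+ ∣ S ∣) / 1

  ToughnessIs : ℚ → Set
  ToughnessIs t = IsTough t × (∀ t' → t < t' → ¬ IsTough t')

  -- τ(G) < t  (the set of t with G t-tough is downward closed, and τ is
  -- attained when finite, so τ(G) < t  iff  G is not t-tough)
  ToughnessBelow : ℚ → Set
  ToughnessBelow t = ¬ IsTough t

  deleteEdge : Fin (length (edges G)) → MGraph
  deleteEdge e = record { n = n G ; edges = removeAt (edges G) e }

  CutVertex : Fin (n G) → Set
  CutVertex v = Σ ℕ λ k → Σ ℕ λ k' →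
    Components ∅ k × Components ⁅ v ⁆ k' × k <ℕ k'

MinimallyTough : MGraph → ℚ → Set
MinimallyTough G t = ToughnessIs G t × (∀ e → ToughnessBelow (deleteEdge G e) t)

data Kind : Set where
  ser par : Kind

-- leaf = an edge; node k cs = series/parallel join of the children cs (ordered)
data SPT : Set where
  leaf : SPT
  node : Kind → List SPT → SPT

-- well-formedness: every internal node has ≥ 2 children, and series and
-- parallel nodes alternate along root-to-leaf paths
ChildOK : Kind → SPT → Set
ChildOK k leaf        = ⊤
ChildOK k (node k' _) = k ≢ k'

mutual
  WF : SPT → Set
  WF leaf        = ⊤
  WF (node k cs) = (2 ≤ℕ length cs) × AllWF k cs

  AllWF : Kind → List SPT → Set
  AllWF k []       = ⊤
  AllWF k (c ∷ cs) = ChildOK k c × WF c × AllWF k cs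

-- A tree T yields a graph on
-- Fin (2 + inner T), with s = 0, t = 1, and 2.. the non-terminal vertices.
-- k-ary joins are realised as iterated binary joins (same graph).

joinSize : Kind → ℕ → ℕ → ℕ
joinSize ser m₁ m₂ = suc (m₁ + m₂)   -- t₁ = s₂ becomes a new inner vertex
joinSize par m₁ m₂ = m₁ + m₂

-- embeddings of the two joined graphs into the join
-- series: 0 ↦ s, 1 ↦ t, 2 ↦ middle vertex t₁ = s₂
joinL : ∀ k m₁ m₂ → Fin (2 + m₁) → Fin (2 + joinSize k m₁ m₂)
joinL ser m₁ m₂ zero             = zero
joinL ser m₁ m₂ (suc zero)       = suc (suc zero)
joinL ser m₁ m₂ (suc (suc i))    = suc (suc (suc (i ↑ˡ m₂)))
joinL par m₁ m₂ zero             = zero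
joinL par m₁ m₂ (suc zero)       = suc zero
joinL par m₁ m₂ (suc (suc i))    = suc (suc (i ↑ˡ m₂))

joinR : ∀ k m₁ m₂ → Fin (2 + m₂) → Fin (2 + joinSize k m₁ m₂)
joinR ser m₁ m₂ zero             = suc (suc zero)
joinR ser m₁ m₂ (suc zero)       = suc zero
joinR ser m₁ m₂ (suc (suc j))    = suc (suc (suc (m₁ ↑ʳ j)))
joinR par m₁ m₂ zero             = zero
joinR par m₁ m₂ (suc zero)       = suc zero
joinR par m₁ m₂ (suc (suc j))    = suc (suc (m₁ ↑ʳ j))

mutual
  inner : SPT → ℕ
  inner leaf        = 0
  inner (node k cs) = innerList k cs

  innerList : Kind → List SPT → ℕ
  innerList k []            = 0
  innerList k (c ∷ [])      = inner c
  innerList k (c ∷ c' ∷ cs) = joinSize k (inner c) (innerList k (c' ∷ cs))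

mapPair : ∀ {a b} → (Fin a → Fin b) → Fin a × Fin a → Fin b × Fin b
mapPair f (u , v) = f u , f v

mutual
  edgesOf : (T : SPT) → List (Fin (2 + inner T) × Fin (2 + inner T))
  edgesOf leaf        = (zero , suc zero) ∷ []
  edgesOf (node k cs) = edgesList k cs

  edgesList : (k : Kind) (cs : List SPT) →
              List (Fin (2 + innerList k cs) × Fin (2 + innerList k cs))
  edgesList k []            = []
  edgesList k (c ∷ [])      = edgesOf c
  edgesList k (c ∷ c' ∷ cs) =
    map (mapPair (joinL k (inner c) (innerList k (c' ∷ cs)))) (edgesOf c)
    ++ map (mapPair (joinR k (inner c) (innerList k (c' ∷ cs)))) (edgesList k (c' ∷ cs))

graphOf : SPT → MGraph
graphOf T = record { n = 2 + inner T ; edges = edgesOf T }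

childEmb : (k : Kind) (cs : List SPT) (i : Fin (length cs)) →
           Fin (2 + inner (lookup cs i)) → Fin (2 + innerList k cs)
childEmb k (c ∷ [])      zero    = id
childEmb k (c ∷ c' ∷ cs) zero    = joinL k (inner c) (innerList k (c' ∷ cs))
childEmb k (c ∷ c' ∷ cs) (suc i) =
  joinR k (inner c) (innerList k (c' ∷ cs)) ∘ childEmb k (c' ∷ cs) i

data Pos : SPT → Set where
  root  : ∀ {T} → Pos T
  child : ∀ {k cs} (i : Fin (length cs)) → Pos (lookup cs i) → Pos (node k cs)

subAt : (T : SPT) → Pos T → SPT
subAt T root                  = T
subAt (node k cs) (child i p) = subAt (lookup cs i) p

embAt : (T : SPT) (p : Pos T) → Fin (2 + inner (subAt T p)) → Fin (2 + inner T)
embAt T root                  = id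
embAt (node k cs) (child i p) = childEmb k cs i ∘ embAt (lookup cs i) p

P₂ : SPT
P₂ = node ser (leaf ∷ leaf ∷ [])

R₂ : SPT
R₂ = node par (P₂ ∷ P₂ ∷ [])

-- A node x of T is the root of an R_{2,1} substructure iff x is a series node
-- whose children are  pre ++ R₂ ∷ leaf ∷ post  (R₂ immediately followed by an
-- edge).
R21Children : List SPT → List SPT → List SPT
R21Children pre post = pre ++ R₂ ∷ leaf ∷ post

r2Index : (pre post : List SPT) → Fin (length (R21Children pre post))
r2Index []        post = zero
r2Index (x ∷ pre) post = suc (r2Index pre post)

s₁At : (T : SPT) (p : Pos T) (pre post : List SPT) →
       subAt T p ≡ node ser (R21Children pre post) → Fin (2 + inner T)
s₁At T p pre post eq =
  embAt T p (subst (λ X → Fin (2 + inner X)) (sym eq)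
    (childEmb ser (R21Children pre post) (r2Index pre post) zero))

{-# OPTIONS --safe #-}
-- Write the R₂ as the 4-cycle s₁ v₁ t₁ v₂ followed by the edge t₁ t₂. Unless the R₂,₁ hangs
-- from the root with a predecessor, G contains a 4-cycle a v b w with N(w) = {a, b},
-- N(b) ⊆ {v, w, z} and G - b connected: away from the root take b = t₁ (the parent of a
-- non-root series node is parallel, so t₁ is no cut vertex); as first child of the root take
-- b = s₁ = s, of degree two. Deleting e = av keeps G ½-tough, contradicting minimality: a
-- cutset S of G - e with more than 2|S| components must separate a from v, hence contains w
-- or b; putting that vertex back loses at most one component while |S| drops by one, and
-- S = {b} is excluded because G - b is connected. In the remaining case s₁ is a junction of
-- the root series node, so it separates s from t.
module Submission where

open import Defs
open import Data.Bool using (Bool; true; false)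
open import Data.Empty using (⊥; ⊥-elim)
open import Data.Fin using (Fin; zero; suc; _↑ˡ_; _↑ʳ_; splitAt; punchIn; punchOut; _≟_)
import Data.Fin.Properties as Finₚ
open import Data.Fin.Subset using (Subset; _∈_; _∉_; ∣_∣; ⁅_⁆; _-_) renaming (⊥ to ∅)
import Data.Fin.Subset.Properties as Subsetₚ
import Data.Integer as ℤ
import Data.Integer.Properties as ℤₚ
open import Data.List using (List; []; _∷_; _++_; length; lookup; map; filter; removeAt)
open import Data.List.Membership.Propositional using () renaming (_∈_ to _∈ₗ_)
open import Data.List.Membership.Propositional.Properties
  using (∈-lookup; ∈-map⁺; ∈-map⁻; ∈-++⁺ˡ; ∈-++⁺ʳ; ∈-++⁻; ∈-filter⁺)
open import Data.List.Relation.Unary.Any as Any using (here; there)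
open import Data.List.Relation.Unary.Any.Properties using (lookup-index)
open import Data.Nat as ℕ using (ℕ; zero; suc; _+_; _≤_; _<_; _*_; s≤s; z≤n)
import Data.Nat.Properties as ℕₚ
open import Data.Product using (Σ; ∃; _×_; _,_; proj₁; proj₂; curry)
open import Data.Product.Properties using (,-injective)
open import Data.Rational as ℚ using (½; toℚᵘ)
import Data.Rational.Properties as ℚₚ
open import Data.Rational.Unnormalised as ℚᵘ using (mkℚᵘ; *≤*; _≃_)
import Data.Rational.Unnormalised.Properties as ℚᵘₚ
open import Data.Sum using (_⊎_; inj₁; inj₂; [_,_])
import Data.Sum
open import Data.Unit using (⊤; tt)
import Data.Vec.Base as Vec
open import Function using (_∘_; id)
open import Function.Bundles using (_⇔_; mk⇔; Equivalence)
open import Relation.Nullary using (¬_; yes; no; Dec)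
open import Relation.Binary.PropositionalEquality hiding ([_]; J)

½*k≤s⇔k≤2*s : ∀ k s → (½ ℚ.* (ℤ.+ k ℚ./ 1) ℚ.≤ ℤ.+ s ℚ./ 1) ⇔ (k ≤ 2 * s)
½*k≤s⇔k≤2*s k s = mk⇔ to from
  where
  nat : ∀ j → toℚᵘ (ℤ.+ j ℚ./ 1) ≃ mkℚᵘ (ℤ.+ j) 0
  nat j = ℚₚ.toℚᵘ-fromℚᵘ (mkℚᵘ (ℤ.+ j) 0)
  half : toℚᵘ (½ ℚ.* (ℤ.+ k ℚ./ 1)) ≃ mkℚᵘ (ℤ.+ 1) 1 ℚᵘ.* mkℚᵘ (ℤ.+ k) 0
  half = ℚᵘₚ.≃-trans (ℚₚ.toℚᵘ-homo-* ½ (ℤ.+ k ℚ./ 1)) (ℚᵘₚ.*-congˡ {mkℚᵘ (ℤ.+ 1) 1} (nat k))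
  -- ½ · k ≤ s in ℚᵘ, cross-multiplied
  lhs : (ℤ.+ 1 ℤ.* ℤ.+ k) ℤ.* ℤ.+ 1 ≡ ℤ.+ k
  lhs = trans (ℤₚ.*-identityʳ _) (ℤₚ.*-identityˡ _)
  rhs : ℤ.+ s ℤ.* ℤ.+ 2 ≡ ℤ.+ (2 * s)
  rhs = trans (sym (ℤₚ.pos-* s 2)) (cong ℤ.+_ (ℕₚ.*-comm s 2))
  to : ½ ℚ.* (ℤ.+ k ℚ./ 1) ℚ.≤ ℤ.+ s ℚ./ 1 → k ≤ 2 * s
  to h with ℚᵘₚ.≤-respʳ-≃ (nat s) (ℚᵘₚ.≤-respˡ-≃ half (ℚₚ.toℚᵘ-mono-≤ h))
  ... | *≤* q = ℤₚ.drop‿+≤+ (subst₂ ℤ._≤_ lhs rhs q)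
  from : k ≤ 2 * s → ½ ℚ.* (ℤ.+ k ℚ./ 1) ℚ.≤ ℤ.+ s ℚ./ 1
  from h = ℚₚ.toℚᵘ-cancel-≤ (ℚᵘₚ.≤-respʳ-≃ (ℚᵘₚ.≃-sym (nat s))
             (ℚᵘₚ.≤-respˡ-≃ (ℚᵘₚ.≃-sym half) (*≤* (subst₂ ℤ._≤_ (sym lhs) (sym rhs) (ℤ.+≤+ h)))))

Adj-sym : ∀ (G : MGraph) {u v} → Adj G u v → Adj G v u
Adj-sym G (inj₁ uv) = inj₂ uv
Adj-sym G (inj₂ vu) = inj₁ vu

EdgeInvariant : ∀ {A : Set} (G : MGraph) → Subset (n G) → (Fin (n G) → A) → Set
EdgeInvariant G S f = ∀ {x y} → x ∉ S → y ∉ S → Adj G x y → f x ≡ f y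

module _ {G : MGraph} {S : Subset (n G)} where

  Conn-start : ∀ {u v} → Conn G S u v → u ∉ S
  Conn-start (conn-refl u∉S)   = u∉S
  Conn-start (conn-step p _ _) = Conn-start p

  Conn-end : ∀ {u v} → Conn G S u v → v ∉ S
  Conn-end (conn-refl v∉S)     = v∉S
  Conn-end (conn-step _ _ v∉S) = v∉S

  Conn-edge : ∀ {u v} → u ∉ S → Adj G u v → v ∉ S → Conn G S u v
  Conn-edge u∉S uv v∉S = conn-step (conn-refl u∉S) uv v∉S

  Conn-trans : ∀ {u v w} → Conn G S u v → Conn G S v w → Conn G S u w
  Conn-trans p (conn-refl _)         = p
  Conn-trans p (conn-step q vw w∉S) = conn-step (Conn-trans p q) vw w∉S

  Conn-sym : ∀ {u v} → Conn G S u v → Conn G S v u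
  Conn-sym (conn-refl u∉S)      = conn-refl u∉S
  Conn-sym (conn-step p vw w∉S) = Conn-trans (Conn-edge w∉S (Adj-sym G vw) (Conn-end p)) (Conn-sym p)

  Conn-invariant : ∀ {A : Set} {f : Fin (n G) → A} → EdgeInvariant G S f →
                   ∀ {u v} → Conn G S u v → f u ≡ f v
  Conn-invariant inv (conn-refl _)         = refl
  Conn-invariant inv (conn-step p vw w∉S) = trans (Conn-invariant inv p) (inv (Conn-end p) w∉S vw)

Conn-map : ∀ {G H : MGraph} {S : Subset (n G)} {T : Subset (n H)} (φ : Fin (n G) → Fin (n H)) →
           (∀ {x y} → Adj G x y → Adj H (φ x) (φ y)) → (∀ {x} → x ∉ S → φ x ∉ T) →
           ∀ {u v} → Conn G S u v → Conn H T (φ u) (φ v)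
Conn-map φ adj avoid (conn-refl u∉S)      = conn-refl (avoid u∉S)
Conn-map φ adj avoid (conn-step p vw w∉S) = conn-step (Conn-map φ adj avoid p) (adj vw) (avoid w∉S)

Conn-weaken : ∀ {G : MGraph} {S T : Subset (n G)} → (∀ {x} → x ∉ S → x ∉ T) →
              ∀ {u v} → Conn G S u v → Conn G T u v
Conn-weaken = Conn-map id id

-- By η, every G is graph (n G) (edges G), so lemmas about graph V E apply to G, deleteEdge G e, ….
graph : (V : ℕ) → List (Fin V × Fin V) → MGraph
graph V E = record { n = V ; edges = E }

EdgesWalkable : ∀ {V} (E F : List (Fin V × Fin V)) → Subset V → Set
EdgesWalkable {V} E F S = ∀ {x y} → x ∉ S → y ∉ S → Adj (graph V E) x y → Conn (graph V F) S x y

Conn-reroute : ∀ {V} {E F : List (Fin V × Fin V)} {S : Subset V} → EdgesWalkable E F S →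
               ∀ {u v} → Conn (graph V E) S u v → Conn (graph V F) S u v
Conn-reroute walk (conn-refl u∉S)      = conn-refl u∉S
Conn-reroute walk (conn-step p vw w∉S) = Conn-trans (Conn-reroute walk p) (walk (Conn-end p) w∉S vw)

-- Components via class functions

record Classification (G : MGraph) (S : Subset (n G)) (k : ℕ) : Set where
  field
    class       : Fin (n G) → Fin k
    rep         : Fin k → Fin (n G)
    rep∉        : ∀ i → rep i ∉ S
    class-rep   : ∀ i → class (rep i) ≡ i
    class-inv   : EdgeInvariant G S class
    reaches-rep : ∀ {x} → x ∉ S → Conn G S x (rep (class x))

  Conn⇒class≡ : ∀ {x y} → Conn G S x y → class x ≡ class y
  Conn⇒class≡ = Conn-invariant class-inv

  class≡⇒Conn : ∀ {x y} → x ∉ S → y ∉ S → class x ≡ class y → Conn G S x y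
  class≡⇒Conn {y = y} x∉S y∉S eq =
    Conn-trans (reaches-rep x∉S) (subst (λ i → Conn G S (rep i) y) (sym eq) (Conn-sym (reaches-rep y∉S)))

module _ {G : MGraph} {S : Subset (n G)} where

  toComponents : ∀ {k} → Classification G S k → Components G S k
  toComponents c = rep , rep∉ , distinct , λ x x∉S → class x , reaches-rep x∉S
    where
    open Classification c
    distinct : ∀ i j → Conn G S (rep i) (rep j) → i ≡ j
    distinct i j p = trans (sym (class-rep i)) (trans (Conn⇒class≡ p) (class-rep j))

  -- vertices of S are sent to the junk class zero
  classify : ∀ {m} → Components G S (suc m) → Classification G S (suc m)
  classify {m} (rep , rep∉ , distinct , covered) = record
    { class       = class
    ; rep         = rep
    ; rep∉        = rep∉
    ; class-rep   = λ i → sym (distinct i (class (rep i)) (reaches-rep (rep∉ i)))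
    ; class-inv   = λ x∉S y∉S xy → class-Conn (Conn-edge x∉S xy y∉S)
    ; reaches-rep = reaches-rep
    }
    where
    class : Fin (n G) → Fin (suc m)
    class x with x Subsetₚ.∈? S
    ... | yes _   = zero
    ... | no x∉S = proj₁ (covered x x∉S)

    reaches-rep : ∀ {x} → x ∉ S → Conn G S x (rep (class x))
    reaches-rep {x} x∉S with x Subsetₚ.∈? S
    ... | yes x∈S = ⊥-elim (x∉S x∈S)
    ... | no x∉S′ = proj₂ (covered x x∉S′)

    class-Conn : ∀ {x y} → Conn G S x y → class x ≡ class y
    class-Conn {x} {y} p = distinct _ _
      (Conn-trans (Conn-sym (reaches-rep (Conn-start p))) (Conn-trans p (reaches-rep (Conn-end p))))

Classification-reroute : ∀ {V} {E F : List (Fin V × Fin V)} {S : Subset V} {k} →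
  EdgesWalkable E F S → EdgesWalkable F E S → Classification (graph V E) S k → Classification (graph V F) S k
Classification-reroute E⇒F F⇒E c = record
  { class       = class
  ; rep         = rep
  ; rep∉        = rep∉
  ; class-rep   = class-rep
  ; class-inv   = λ x∉S y∉S xy → Conn⇒class≡ (F⇒E x∉S y∉S xy)
  ; reaches-rep = λ x∉S → Conn-reroute E⇒F (reaches-rep x∉S)
  }
  where open Classification c

addEdge : (G : MGraph) → Fin (n G) → Fin (n G) → MGraph
addEdge G u v = record { n = n G ; edges = (u , v) ∷ edges G }

-- merge identifies class j with class i, and unmerge is a section of it
module Merge {m : ℕ} {i j : Fin (suc m)} (i≢j : i ≢ j) where

  merge : Fin (suc m) → Fin m
  merge x with x ≟ j
  ... | yes _   = punchOut (i≢j ∘ sym)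
  ... | no x≢j = punchOut (x≢j ∘ sym)

  unmerge : Fin m → Fin (suc m)
  unmerge = punchIn j

  merge-unmerge : ∀ l → merge (unmerge l) ≡ l
  merge-unmerge l with unmerge l ≟ j
  ... | yes eq = ⊥-elim (Finₚ.punchInᵢ≢i j l eq)
  ... | no _   = trans (Finₚ.punchOut-cong j refl) (Finₚ.punchOut-punchIn j)

  unmerge-merge : ∀ {x} → x ≢ j → unmerge (merge x) ≡ x
  unmerge-merge {x} x≢j with x ≟ j
  ... | yes x≡j = ⊥-elim (x≢j x≡j)
  ... | no _    = Finₚ.punchIn-punchOut _

  merge-j : merge j ≡ merge i
  merge-j with j ≟ j | i ≟ j
  ... | no j≢j | _      = ⊥-elim (j≢j refl)
  ... | yes _  | yes i≡j = ⊥-elim (i≢j i≡j)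
  ... | yes _  | no _    = Finₚ.punchOut-cong j refl

  unmerge-merge-j : unmerge (merge j) ≡ i
  unmerge-merge-j = trans (cong unmerge merge-j) (unmerge-merge i≢j)

SamePair : ∀ {V} → Fin V → Fin V → Fin V → Fin V → Set
SamePair x y u v = (x ≡ u × y ≡ v) ⊎ (x ≡ v × y ≡ u)

SamePair-sym : ∀ {V} {x y u v : Fin V} → SamePair x y u v → SamePair y x u v
SamePair-sym (inj₁ (x≡u , y≡v)) = inj₂ (y≡v , x≡u)
SamePair-sym (inj₂ (x≡v , y≡u)) = inj₁ (y≡u , x≡v)

SamePair-Adj : ∀ {G : MGraph} {u v x y} → Adj G u v → SamePair x y u v → Adj G x y
SamePair-Adj {G} uv (inj₁ (refl , refl)) = uv
SamePair-Adj {G} uv (inj₂ (refl , refl)) = Adj-sym G uv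

module _ {G : MGraph} {u v : Fin (n G)} where

  Adj-addEdge⁺ : ∀ {x y} → Adj G x y → Adj (addEdge G u v) x y
  Adj-addEdge⁺ (inj₁ xy) = inj₁ (there xy)
  Adj-addEdge⁺ (inj₂ yx) = inj₂ (there yx)

  Adj-addEdge-new : Adj (addEdge G u v) u v
  Adj-addEdge-new = inj₁ (here refl)

  Adj-addEdge⁻ : ∀ {x y} → Adj (addEdge G u v) x y → Adj G x y ⊎ SamePair x y u v
  Adj-addEdge⁻ (inj₁ (here refl)) = inj₂ (inj₁ (refl , refl))
  Adj-addEdge⁻ (inj₁ (there xy))  = inj₁ (inj₁ xy)
  Adj-addEdge⁻ (inj₂ (here refl)) = inj₂ (inj₂ (refl , refl))
  Adj-addEdge⁻ (inj₂ (there yx))  = inj₁ (inj₂ yx)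

Conn-addEdge⁺ : ∀ {G : MGraph} {S : Subset (n G)} {u v x y} → Conn G S x y → Conn (addEdge G u v) S x y
Conn-addEdge⁺ = Conn-map id Adj-addEdge⁺ id

Classification-addEdge : ∀ {G : MGraph} {S : Subset (n G)} {m} (c : Classification G S (suc m)) →
  let open Classification c in
  ∀ {u v} → u ∉ S → v ∉ S → class u ≢ class v → Classification (addEdge G u v) S m
Classification-addEdge {G} {S} c {u} {v} u∉S v∉S class-u≢class-v = record
  { class       = merge ∘ class
  ; rep         = rep ∘ unmerge
  ; rep∉        = rep∉ ∘ unmerge
  ; class-rep   = λ l → trans (cong merge (class-rep (unmerge l))) (merge-unmerge l)
  ; class-inv   = class-inv′
  ; reaches-rep = λ x∉S → Conn-trans (Conn-addEdge⁺ (reaches-rep x∉S)) (rep-to-merged-rep (class _))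
  }
  where
  open Classification c
  open Merge class-u≢class-v
  G⁺ = addEdge G u v

  class-inv′ : EdgeInvariant G⁺ S (merge ∘ class)
  class-inv′ x∉S y∉S xy with Adj-addEdge⁻ xy
  ... | inj₁ xy′                   = cong merge (class-inv x∉S y∉S xy′)
  ... | inj₂ (inj₁ (refl , refl)) = sym merge-j
  ... | inj₂ (inj₂ (refl , refl)) = merge-j

  rep-to-merged-rep : ∀ l → Conn G⁺ S (rep l) (rep (unmerge (merge l)))
  rep-to-merged-rep l = by-cases (l ≟ class v)
    where
    by-cases : Dec (l ≡ class v) → Conn G⁺ S (rep l) (rep (unmerge (merge l)))
    by-cases (no l≢) = subst (λ l′ → Conn G⁺ S (rep l) (rep l′)) (sym (unmerge-merge l≢)) (conn-refl (rep∉ l))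
    by-cases (yes refl) = subst (λ l′ → Conn G⁺ S (rep (class v)) (rep l′)) (sym unmerge-merge-j)
      (Conn-trans (Conn-addEdge⁺ (Conn-sym (reaches-rep v∉S)))
      (Conn-trans (Conn-edge v∉S (Adj-sym G⁺ Adj-addEdge-new) u∉S) (Conn-addEdge⁺ (reaches-rep u∉S))))

module _ {V : ℕ} {S : Subset V} {w : Fin V} where

  ∉-minus : ∀ {x} → x ∉ S → x ∉ S - w
  ∉-minus x∉S x∈S-w = x∉S (Subsetₚ.p─q⊆p S ⁅ w ⁆ x∈S-w)

  ∉-minus⁻ : ∀ {x} → x ∉ S - w → x ≢ w → x ∉ S
  ∉-minus⁻ x∉S-w x≢w x∈S = x∉S-w (Subsetₚ.x∈p∧x≢y⇒x∈p-y x∈S x≢w)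

x∉p-x : ∀ {V} (S : Subset V) x → x ∉ S - x
x∉p-x (_ Vec.∷ S) zero    ()
x∉p-x (_ Vec.∷ S) (suc x) (Vec.there x∈S-x) = x∉p-x S x x∈S-x

redirect : ∀ {V} → Fin V → Fin V → Fin V → Fin V
redirect w w′ x with x ≟ w
... | yes _ = w′
... | no _  = x

module _ {V : ℕ} {w w′ : Fin V} where

  redirect-≡ : redirect w w′ w ≡ w′
  redirect-≡ with w ≟ w
  ... | yes _  = refl
  ... | no w≢w = ⊥-elim (w≢w refl)

  redirect-≢ : ∀ {x} → x ≢ w → redirect w w′ x ≡ x
  redirect-≢ {x} x≢w with x ≟ w
  ... | yes x≡w = ⊥-elim (x≢w x≡w)
  ... | no _    = refl

Classification-restore : ∀ {G : MGraph} {S : Subset (n G)} {k} (c : Classification G S k) →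
  let open Classification c in
  ∀ {w y₀} → w ∈ S → y₀ ∉ S → Adj G w y₀ → (∀ {y} → Adj G w y → y ∉ S → class y ≡ class y₀) →
  Classification G (S - w) k
Classification-restore {G} {S} c {w} {y₀} w∈S y₀∉S wy₀ same-class = record
  { class       = class ∘ absorb
  ; rep         = rep
  ; rep∉        = ∉-minus ∘ rep∉
  ; class-rep   = λ i → trans (cong class (redirect-≢ (rep≢w i))) (class-rep i)
  ; class-inv   = class-inv′
  ; reaches-rep = reaches-rep′
  }
  where
  open Classification c
  -- w joins the class of its neighbour y₀
  absorb = redirect w y₀

  rep≢w : ∀ i → rep i ≢ w
  rep≢w i refl = rep∉ i w∈S

  class-inv′ : EdgeInvariant G (S - w) (class ∘ absorb)
  class-inv′ {x} {y} x∉ y∉ xy = by-cases (x ≟ w) (y ≟ w)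
    where
    from-w : ∀ {z} → z ≢ w → z ∉ S - w → Adj G w z → class (absorb w) ≡ class (absorb z)
    from-w z≢w z∉ wz = trans (cong class (redirect-≡ {w = w}))
                         (trans (sym (same-class wz (∉-minus⁻ z∉ z≢w))) (cong class (sym (redirect-≢ z≢w))))
    by-cases : Dec (x ≡ w) → Dec (y ≡ w) → class (absorb x) ≡ class (absorb y)
    by-cases (yes refl) (yes refl) = refl
    by-cases (yes refl) (no y≢w)   = from-w y≢w y∉ xy
    by-cases (no x≢w)   (yes refl) = sym (from-w x≢w x∉ (Adj-sym G xy))
    by-cases (no x≢w)   (no y≢w)   = trans (cong class (redirect-≢ x≢w))
      (trans (class-inv (∉-minus⁻ x∉ x≢w) (∉-minus⁻ y∉ y≢w) xy) (cong class (sym (redirect-≢ y≢w))))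

  reaches-rep′ : ∀ {x} → x ∉ S - w → Conn G (S - w) x (rep (class (absorb x)))
  reaches-rep′ {x} x∉ with x ≟ w
  ... | yes refl = Conn-trans (Conn-edge x∉ wy₀ (∉-minus y₀∉S)) (Conn-weaken ∉-minus (reaches-rep y₀∉S))
  ... | no x≢w   = Conn-weaken ∉-minus (reaches-rep (∉-minus⁻ x∉ x≢w))

Classification-restore-merge : ∀ {G : MGraph} {S : Subset (n G)} {m} (c : Classification G S (suc m)) →
  let open Classification c in
  ∀ {w y₀ y₁} → w ∈ S → y₀ ∉ S → y₁ ∉ S → Adj G w y₀ → Adj G w y₁ → class y₀ ≢ class y₁ →
  (∀ {y} → Adj G w y → y ∉ S → class y ≡ class y₀ ⊎ class y ≡ class y₁) →
  Classification G (S - w) m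
Classification-restore-merge {G} {S} c {w} {y₀} {y₁} w∈S y₀∉S y₁∉S wy₀ wy₁ classes≢ two-classes =
  -- a virtual edge y₀y₁ merges the two classes; once w is back, the path y₀ w y₁ replaces it
  Classification-reroute old-edges new-edges
    (Classification-restore merged w∈S y₀∉S (Adj-addEdge⁺ wy₀) same-merged-class)
  where
  open Classification c
  open Merge classes≢
  G⁺ = addEdge G y₀ y₁
  merged = Classification-addEdge c y₀∉S y₁∉S classes≢

  w≢ : ∀ {y} → y ∉ S → w ≢ y
  w≢ y∉S refl = y∉S w∈S

  Adj-w : ∀ {y} → Adj G⁺ w y → Adj G w y
  Adj-w wy with Adj-addEdge⁻ wy
  ... | inj₁ wy′               = wy′
  ... | inj₂ (inj₁ (w≡y₀ , _)) = ⊥-elim (w≢ y₀∉S w≡y₀)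
  ... | inj₂ (inj₂ (w≡y₁ , _)) = ⊥-elim (w≢ y₁∉S w≡y₁)

  same-merged-class : ∀ {y} → Adj G⁺ w y → y ∉ S → merge (class y) ≡ merge (class y₀)
  same-merged-class wy y∉S with two-classes (Adj-w wy) y∉S
  ... | inj₁ eq = cong merge eq
  ... | inj₂ eq = trans (cong merge eq) merge-j

  old-edges : EdgesWalkable (edges G⁺) (edges G) (S - w)
  old-edges x∉ y∉ xy with Adj-addEdge⁻ xy
  ... | inj₁ xy′                   = Conn-edge x∉ xy′ y∉
  ... | inj₂ (inj₁ (refl , refl)) = Conn-trans (Conn-edge x∉ (Adj-sym G wy₀) (x∉p-x S w)) (Conn-edge (x∉p-x S w) wy₁ y∉)
  ... | inj₂ (inj₂ (refl , refl)) = Conn-trans (Conn-edge x∉ (Adj-sym G wy₁) (x∉p-x S w)) (Conn-edge (x∉p-x S w) wy₀ y∉)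

  new-edges : EdgesWalkable (edges G) (edges G⁺) (S - w)
  new-edges x∉ y∉ xy = Conn-edge x∉ (Adj-addEdge⁺ xy) y∉

½-tough⇒bound : ∀ {G : MGraph} {S k} → IsTough G ½ → Classification G S k → 1 < k → k ≤ 2 * ∣ S ∣
½-tough⇒bound {S = S} {k} tough c 1<k = Equivalence.to (½*k≤s⇔k≤2*s k ∣ S ∣) (tough S k (toComponents c) 1<k)

bound⇒½-tough : ∀ {G : MGraph} →
  (∀ S m → Classification G S (suc m) → 1 < suc m → suc m ≤ 2 * ∣ S ∣) → IsTough G ½
bound⇒½-tough bound S (suc m) C 1<k = Equivalence.from (½*k≤s⇔k≤2*s (suc m) ∣ S ∣) (bound S m (classify C) 1<k)

connected⇒k≤1 : ∀ {G : MGraph} {S : Subset (n G)} {k c} → Classification G S k →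
                (∀ {x} → x ∉ S → Conn G S x c) → k ≤ 1
connected⇒k≤1 {k = zero}        _ _        = z≤n
connected⇒k≤1 {k = suc zero}    _ _        = s≤s z≤n
connected⇒k≤1 {k = suc (suc k)} cl connected = ⊥-elim (Finₚ.0≢1+n (class≡ zero (suc zero)))
  where
  open Classification cl
  class≡ : ∀ i j → i ≡ j
  class≡ i j = trans (sym (class-rep i))
    (trans (Conn⇒class≡ (Conn-trans (connected (rep∉ i)) (Conn-sym (connected (rep∉ j))))) (class-rep j))

∈⇒1≤∣p∣ : ∀ {V} {S : Subset V} {x} → x ∈ S → 1 ≤ ∣ S ∣
∈⇒1≤∣p∣ x∈S = ℕₚ.≤-trans (s≤s z≤n) (Subsetₚ.x∈p⇒∣p-x∣<∣p∣ x∈S)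

∣p∣≤1⇒⊆⁅x⁆ : ∀ {V} {S : Subset V} {x y} → ∣ S ∣ ≤ 1 → x ∈ S → y ∈ S → y ≡ x
∣p∣≤1⇒⊆⁅x⁆ {x = x} {y} ∣S∣≤1 x∈S y∈S with y ≟ x
... | yes y≡x = y≡x
... | no y≢x  = ⊥-elim (ℕₚ.<⇒≱ (Subsetₚ.x∈p⇒∣p-x∣<∣p∣ x∈S)
                 (ℕₚ.≤-trans ∣S∣≤1 (∈⇒1≤∣p∣ (Subsetₚ.x∈p∧x≢y⇒x∈p-y y∈S y≢x))))

∈-removeAt⁻ : ∀ {A : Set} (xs : List A) i {x} → x ∈ₗ removeAt xs i → x ∈ₗ xs
∈-removeAt⁻ (y ∷ xs) zero    x∈        = there x∈
∈-removeAt⁻ (y ∷ xs) (suc i) (here x≡y) = here x≡y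
∈-removeAt⁻ (y ∷ xs) (suc i) (there x∈) = there (∈-removeAt⁻ xs i x∈)

∈⇒≡lookup⊎∈-removeAt : ∀ {A : Set} (xs : List A) i {x} → x ∈ₗ xs → x ≡ lookup xs i ⊎ x ∈ₗ removeAt xs i
∈⇒≡lookup⊎∈-removeAt (y ∷ xs) zero    (here x≡y) = inj₁ x≡y
∈⇒≡lookup⊎∈-removeAt (y ∷ xs) zero    (there x∈) = inj₂ x∈
∈⇒≡lookup⊎∈-removeAt (y ∷ xs) (suc i) (here x≡y) = inj₂ (here x≡y)
∈⇒≡lookup⊎∈-removeAt (y ∷ xs) (suc i) (there x∈) with ∈⇒≡lookup⊎∈-removeAt xs i x∈
... | inj₁ x≡ = inj₁ x≡
... | inj₂ x∈′ = inj₂ (there x∈′)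

Joins : (G : MGraph) → Fin (length (edges G)) → Fin (n G) → Fin (n G) → Set
Joins G e u v = lookup (edges G) e ≡ (u , v) ⊎ lookup (edges G) e ≡ (v , u)

∈⇒Joins : ∀ {G : MGraph} {u v} (uv : (u , v) ∈ₗ edges G) → Joins G (Any.index uv) u v
∈⇒Joins uv = inj₁ (sym (lookup-index uv))

module _ {G : MGraph} {e : Fin (length (edges G))} where

  Joins⇒Adj : ∀ {u v} → Joins G e u v → Adj G u v
  Joins⇒Adj (inj₁ eq) = inj₁ (subst (_∈ₗ edges G) eq (∈-lookup e))
  Joins⇒Adj (inj₂ eq) = inj₂ (subst (_∈ₗ edges G) eq (∈-lookup e))

  Joins-ends : ∀ {u v x y} → Joins G e u v → (x , y) ≡ lookup (edges G) e → SamePair x y u v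
  Joins-ends (inj₁ e≡) eq = inj₁ (,-injective (trans eq e≡))
  Joins-ends (inj₂ e≡) eq = inj₂ (,-injective (trans eq e≡))

  Adj-deleteEdge⁻ : ∀ {x y} → Adj (deleteEdge G e) x y → Adj G x y
  Adj-deleteEdge⁻ (inj₁ xy) = inj₁ (∈-removeAt⁻ (edges G) e xy)
  Adj-deleteEdge⁻ (inj₂ yx) = inj₂ (∈-removeAt⁻ (edges G) e yx)

  Adj-deleteEdge⁺ : ∀ {u v} → Joins G e u v → ∀ {x y} → Adj G x y → Adj (deleteEdge G e) x y ⊎ SamePair x y u v
  Adj-deleteEdge⁺ e-joins (inj₁ xy) with ∈⇒≡lookup⊎∈-removeAt (edges G) e xy
  ... | inj₁ eq  = inj₂ (Joins-ends e-joins eq)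
  ... | inj₂ xy′ = inj₁ (inj₁ xy′)
  Adj-deleteEdge⁺ e-joins (inj₂ yx) with ∈⇒≡lookup⊎∈-removeAt (edges G) e yx
  ... | inj₁ eq  = inj₂ (SamePair-sym (Joins-ends e-joins eq))
  ... | inj₂ yx′ = inj₁ (inj₂ yx′)

record RemovableEdge (G : MGraph) : Set where
  field
    e             : Fin (length (edges G))
    a v b w z     : Fin (n G)
    e-joins       : Joins G e a v
    v~b           : Adj G v b
    a~w           : Adj G a w
    w~b           : Adj G w b
    b~z           : Adj G b z
    N[w]          : ∀ {x} → Adj G w x → x ≡ a ⊎ x ≡ b
    N[b]          : ∀ {x} → Adj G b x → x ≡ v ⊎ x ≡ w ⊎ x ≡ z
    a≢b           : a ≢ b
    a≢w           : a ≢ w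
    v≢w           : v ≢ w
    G-b-connected : ∀ {x} → x ≢ b → Conn G ⁅ b ⁆ x a

2s≤m≤1+k≤2s′<2s : ∀ {k m s s′} → 2 * s ≤ m → m ≤ suc k → k ≤ 2 * s′ → s′ < s → ⊥
2s≤m≤1+k≤2s′<2s {k} {m} {s} {s′} 2s≤m m≤1+k k≤2s′ s′<s = ℕₚ.<-irrefl refl (begin-strict
  2 * s        ≤⟨ 2s≤m ⟩
  m            ≤⟨ m≤1+k ⟩
  suc k        ≤⟨ s≤s k≤2s′ ⟩
  suc (2 * s′) <⟨ ℕₚ.n<1+n _ ⟩
  2 + 2 * s′   ≡⟨ ℕₚ.*-suc 2 s′ ⟨
  2 * suc s′   ≤⟨ ℕₚ.*-monoʳ-≤ 2 s′<s ⟩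
  2 * s        ∎)
  where open ℕₚ.≤-Reasoning

module _ {G : MGraph} (tough : IsTough G ½) (R : RemovableEdge G) where
  open RemovableEdge R
  private
    G′ = deleteEdge G e

  Adj-G′ : ∀ {x y} → Adj G x y → ¬ SamePair x y a v → Adj G′ x y
  Adj-G′ xy not-e with Adj-deleteEdge⁺ e-joins xy
  ... | inj₁ xy′ = xy′
  ... | inj₂ is-e = ⊥-elim (not-e is-e)

  a~′w : Adj G′ a w
  a~′w = Adj-G′ a~w λ { (inj₁ (_ , w≡v)) → v≢w (sym w≡v) ; (inj₂ (_ , w≡a)) → a≢w (sym w≡a) }

  w~′b : Adj G′ w b
  w~′b = Adj-G′ w~b λ { (inj₁ (w≡a , _)) → a≢w (sym w≡a) ; (inj₂ (w≡v , _)) → v≢w (sym w≡v) }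

  v~′b : Adj G′ v b
  v~′b = Adj-G′ v~b λ { (inj₁ (v≡a , b≡v)) → a≢b (trans (sym v≡a) (sym b≡v))
                      ; (inj₂ (_ , b≡a))     → a≢b (sym b≡a) }

  -- S is a cutset of G′ with m + 2 > 2 ∣S∣ components
  module _ {S : Subset (n G)} {m} (c′ : Classification G′ S (suc (suc m))) (violation : 2 * ∣ S ∣ ≤ suc m) where
    open Classification c′ using ()
      renaming (class to class′; class≡⇒Conn to class′≡⇒Conn′; Conn⇒class≡ to Conn′⇒class′≡)

    a-v-separated : (a ∈ S ⊎ v ∈ S ⊎ class′ a ≡ class′ v) → ⊥
    a-v-separated not-separated = ℕₚ.<⇒≱ (s≤s violation) (½-tough⇒bound tough c (s≤s (s≤s z≤n)))
      where
      a-v-walk : a ∉ S → v ∉ S → Conn G′ S a v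
      a-v-walk a∉S v∉S = [ ⊥-elim ∘ a∉S , [ ⊥-elim ∘ v∉S , class′≡⇒Conn′ a∉S v∉S ] ] not-separated
      G-edges : EdgesWalkable (edges G) (edges G′) S
      G-edges x∉S y∉S xy with Adj-deleteEdge⁺ e-joins xy
      ... | inj₁ xy′                   = Conn-edge x∉S xy′ y∉S
      ... | inj₂ (inj₁ (refl , refl)) = a-v-walk x∉S y∉S
      ... | inj₂ (inj₂ (refl , refl)) = Conn-sym (a-v-walk y∉S x∉S)
      c : Classification G S (suc (suc m))
      c = Classification-reroute (λ x∉S y∉S xy → Conn-edge x∉S (Adj-deleteEdge⁻ xy) y∉S) G-edges c′

    module _ (a∉S : a ∉ S) (v∉S : v ∉ S) (separated : class′ a ≢ class′ v) where
      private
        G⁺ = addEdge G′ a v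

      cG : Classification G S (suc m)
      cG = Classification-reroute back forth (Classification-addEdge c′ a∉S v∉S separated)
        where
        back : EdgesWalkable (edges G⁺) (edges G) S
        back x∉S y∉S xy with Adj-addEdge⁻ xy
        ... | inj₁ xy′  = Conn-edge x∉S (Adj-deleteEdge⁻ xy′) y∉S
        ... | inj₂ is-e = Conn-edge x∉S (SamePair-Adj (Joins⇒Adj e-joins) is-e) y∉S
        forth : EdgesWalkable (edges G) (edges G⁺) S
        forth x∉S y∉S xy with Adj-deleteEdge⁺ e-joins xy
        ... | inj₁ xy′  = Conn-edge x∉S (Adj-addEdge⁺ xy′) y∉S
        ... | inj₂ is-e = Conn-edge x∉S (SamePair-Adj Adj-addEdge-new is-e) y∉S

      open Classification cG

      2≤1+m : ∀ {x} → x ∈ S → 2 ≤ suc m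
      2≤1+m x∈S = ℕₚ.≤-trans (ℕₚ.*-monoʳ-≤ 2 (∈⇒1≤∣p∣ x∈S)) violation

      restored : ∀ {x} → x ∈ S → Classification G (S - x) (suc m) → ⊥
      restored x∈S c = 2s≤m≤1+k≤2s′<2s violation (ℕₚ.n≤1+n _) (½-tough⇒bound tough c (2≤1+m x∈S))
                         (Subsetₚ.x∈p⇒∣p-x∣<∣p∣ x∈S)

      restored-merged : b ∈ S → Classification G (S - b) m → ⊥
      restored-merged b∈S c with 1 ℕ.<? m
      ... | yes 1<m = 2s≤m≤1+k≤2s′<2s violation ℕₚ.≤-refl (½-tough⇒bound tough c 1<m)
                        (Subsetₚ.x∈p⇒∣p-x∣<∣p∣ b∈S)
      ... | no 1≮m  = ℕₚ.<⇒≱ (2≤1+m b∈S) (connected⇒k≤1 cG connected)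
        where
        ∣S∣≤1 : ∣ S ∣ ≤ 1
        ∣S∣≤1 = ℕₚ.*-cancelˡ-≤ 2 (ℕₚ.≤-trans violation (s≤s (ℕₚ.≮⇒≥ 1≮m)))
        S⊆⁅b⁆ : ∀ {y} → y ∉ ⁅ b ⁆ → y ∉ S
        S⊆⁅b⁆ y∉⁅b⁆ y∈S = y∉⁅b⁆ (subst (_∈ ⁅ b ⁆) (sym (∣p∣≤1⇒⊆⁅x⁆ ∣S∣≤1 b∈S y∈S))
                                         (Subsetₚ.x∈⁅x⁆ b))
        connected : ∀ {x} → x ∉ S → Conn G S x a
        connected x∉S = Conn-weaken S⊆⁅b⁆ (G-b-connected λ { refl → x∉S b∈S })

      N[b]-classes : ∀ {y} → Adj G b y → y ∉ S → class y ≡ class v ⊎ y ≡ z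
      N[b]-classes by y∉S with N[b] by
      ... | inj₁ refl        = inj₁ refl
      ... | inj₂ (inj₁ refl) = inj₁ (trans (sym (class-inv a∉S y∉S a~w)) (class-inv a∉S v∉S (Joins⇒Adj e-joins)))
      ... | inj₂ (inj₂ refl) = inj₂ refl

      b-restored : b ∈ S → ⊥
      b-restored b∈S with z Subsetₚ.∈? S
      ... | yes z∈S = restored b∈S (Classification-restore cG b∈S v∉S (Adj-sym G v~b)
                        λ by y∉S → [ id , (λ { refl → ⊥-elim (y∉S z∈S) }) ] (N[b]-classes by y∉S))
      ... | no z∉S with class z ≟ class v
      ...   | yes same = restored b∈S (Classification-restore cG b∈S v∉S (Adj-sym G v~b)
                           λ by y∉S → [ id , (λ { refl → same }) ] (N[b]-classes by y∉S))
      ...   | no differ = restored-merged b∈S (Classification-restore-merge cG b∈S v∉S z∉S (Adj-sym G v~b) b~z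
                            (differ ∘ sym) λ by y∉S → Data.Sum.map₂ (cong class) (N[b]-classes by y∉S))

      w-restored : b ∉ S → w ∈ S → ⊥
      w-restored b∉S w∈S = restored w∈S (Classification-restore cG w∈S a∉S (Adj-sym G a~w) N[w]-classes)
        where
        N[w]-classes : ∀ {y} → Adj G w y → y ∉ S → class y ≡ class a
        N[w]-classes wy y∉S with N[w] wy
        ... | inj₁ refl = refl
        ... | inj₂ refl = trans (sym (class-inv v∉S y∉S v~b)) (sym (class-inv a∉S v∉S (Joins⇒Adj e-joins)))

      ¬a-v-separated : ⊥
      ¬a-v-separated with b Subsetₚ.∈? S | w Subsetₚ.∈? S
      ... | yes b∈S | _       = b-restored b∈S
      ... | no b∉S  | yes w∈S = w-restored b∉S w∈S
      ... | no b∉S  | no w∉S  = separated (Conn′⇒class′≡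
          (Conn-trans (Conn-edge a∉S a~′w w∉S)
          (Conn-trans (Conn-edge w∉S w~′b b∉S) (Conn-edge b∉S (Adj-sym G′ v~′b) v∉S))))

    no-violation : ⊥
    no-violation with a Subsetₚ.∈? S | v Subsetₚ.∈? S
    ... | yes a∈S | _       = a-v-separated (inj₁ a∈S)
    ... | no a∉S  | yes v∈S = a-v-separated (inj₂ (inj₁ v∈S))
    ... | no a∉S  | no v∉S with class′ a ≟ class′ v
    ...   | yes same  = a-v-separated (inj₂ (inj₂ same))
    ...   | no differ = ¬a-v-separated a∉S v∉S differ

  ½-tough-deleteEdge : IsTough G′ ½
  ½-tough-deleteEdge = bound⇒½-tough bound
    where
    bound : ∀ S m → Classification G′ S (suc m) → 1 < suc m → suc m ≤ 2 * ∣ S ∣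
    bound S zero    c′ (s≤s ())
    bound S (suc m) c′ _ with suc (suc m) ℕ.≤? 2 * ∣ S ∣
    ... | yes fine    = fine
    ... | no violated = ⊥-elim (no-violation c′ (ℕₚ.≤-pred (ℕₚ.≰⇒> violated)))

¬minimally-½-tough : ∀ {G : MGraph} → RemovableEdge G → ¬ MinimallyTough G ½
¬minimally-½-tough R ((tough , _) , critical) = critical (RemovableEdge.e R) (½-tough-deleteEdge tough R)

-- Joins of two-terminal graphs

↑ˡ≢↑ʳ : ∀ {m₁ m₂} (a : Fin m₁) (b : Fin m₂) → a ↑ˡ m₂ ≢ m₁ ↑ʳ b
↑ˡ≢↑ʳ {m₁} {m₂} a b eq
  with () ← trans (sym (Finₚ.splitAt-↑ˡ m₁ a m₂)) (trans (cong (splitAt m₁) eq) (Finₚ.splitAt-↑ʳ m₁ m₂ b))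

↑-view : ∀ m₁ m₂ (j : Fin (m₁ + m₂)) → (∃ λ a → a ↑ˡ m₂ ≡ j) ⊎ (∃ λ b → m₁ ↑ʳ b ≡ j)
↑-view m₁ m₂ j with splitAt m₁ j in eq
... | inj₁ a = inj₁ (a , Finₚ.splitAt⁻¹-↑ˡ eq)
... | inj₂ b = inj₂ (b , Finₚ.splitAt⁻¹-↑ʳ eq)

Inner : ∀ {m} → Fin (2 + m) → Set
Inner zero          = ⊥
Inner (suc zero)    = ⊥
Inner (suc (suc _)) = ⊤

Inner⇒≢s : ∀ {m} {u : Fin (2 + m)} → Inner u → u ≢ zero
Inner⇒≢s {u = suc (suc _)} _ ()

Inner⇒≢t : ∀ {m} {u : Fin (2 + m)} → Inner u → u ≢ suc zero
Inner⇒≢t {u = suc (suc _)} _ ()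

-- the terminal of the left part that the right part's s is glued to
glued : Kind → ∀ {m} → Fin (2 + m)
glued ser = suc zero
glued par = zero

glued≢Inner : ∀ k {m} {u : Fin (2 + m)} → Inner u → glued k ≢ u
glued≢Inner ser inner = Inner⇒≢t inner ∘ sym
glued≢Inner par inner = Inner⇒≢s inner ∘ sym

Overlap : ∀ (k : Kind) {m₁ m₂} → Fin (2 + m₁) → Fin (2 + m₂) → Set
Overlap ser y z = y ≡ suc zero × z ≡ zero
Overlap par y z = (y ≡ zero × z ≡ zero) ⊎ (y ≡ suc zero × z ≡ suc zero)

Overlap⇒¬Inner : ∀ k {m₁ m₂} {y : Fin (2 + m₁)} {z : Fin (2 + m₂)} → Overlap k y z → ¬ Inner y × ¬ Inner z
Overlap⇒¬Inner ser (refl , refl)        = (λ ()) , (λ ())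
Overlap⇒¬Inner par (inj₁ (refl , refl)) = (λ ()) , (λ ())
Overlap⇒¬Inner par (inj₂ (refl , refl)) = (λ ()) , (λ ())

module _ {m₁ m₂ : ℕ} where

  joinL-s : ∀ k → joinL k m₁ m₂ zero ≡ zero
  joinL-s ser = refl
  joinL-s par = refl

  joinR-t : ∀ k → joinR k m₁ m₂ (suc zero) ≡ suc zero
  joinR-t ser = refl
  joinR-t par = refl

  joinR-s : ∀ k → joinR k m₁ m₂ zero ≡ joinL k m₁ m₂ (glued k)
  joinR-s ser = refl
  joinR-s par = refl

  joinL-Inner : ∀ k {u} → Inner u → Inner (joinL k m₁ m₂ u)
  joinL-Inner ser {suc (suc _)} _ = tt
  joinL-Inner par {suc (suc _)} _ = tt

  joinR-Inner : ∀ k {u} → Inner u → Inner (joinR k m₁ m₂ u)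
  joinR-Inner ser {suc (suc _)} _ = tt
  joinR-Inner par {suc (suc _)} _ = tt

  joinL-injective : ∀ k {x y} → joinL k m₁ m₂ x ≡ joinL k m₁ m₂ y → x ≡ y
  joinL-injective ser {zero}        {zero}        _  = refl
  joinL-injective ser {suc zero}    {suc zero}    _  = refl
  joinL-injective ser {suc (suc i)} {suc (suc j)} eq =
    cong (λ i → suc (suc i)) (Finₚ.↑ˡ-injective m₂ i j (Finₚ.suc-injective (Finₚ.suc-injective (Finₚ.suc-injective eq))))
  joinL-injective ser {zero}        {suc zero}    ()
  joinL-injective ser {zero}        {suc (suc _)} ()
  joinL-injective ser {suc zero}    {zero}        ()
  joinL-injective ser {suc zero}    {suc (suc _)} ()
  joinL-injective ser {suc (suc _)} {zero}        ()
  joinL-injective ser {suc (suc _)} {suc zero}    ()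
  joinL-injective par {zero}        {zero}        _  = refl
  joinL-injective par {suc zero}    {suc zero}    _  = refl
  joinL-injective par {suc (suc i)} {suc (suc j)} eq =
    cong (λ i → suc (suc i)) (Finₚ.↑ˡ-injective m₂ i j (Finₚ.suc-injective (Finₚ.suc-injective eq)))
  joinL-injective par {zero}        {suc zero}    ()
  joinL-injective par {zero}        {suc (suc _)} ()
  joinL-injective par {suc zero}    {zero}        ()
  joinL-injective par {suc zero}    {suc (suc _)} ()
  joinL-injective par {suc (suc _)} {zero}        ()
  joinL-injective par {suc (suc _)} {suc zero}    ()

  joinR-injective : ∀ k {x y} → joinR k m₁ m₂ x ≡ joinR k m₁ m₂ y → x ≡ y
  joinR-injective ser {zero}        {zero}        _  = refl
  joinR-injective ser {suc zero}    {suc zero}    _  = refl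
  joinR-injective ser {suc (suc i)} {suc (suc j)} eq =
    cong (λ i → suc (suc i)) (Finₚ.↑ʳ-injective m₁ i j (Finₚ.suc-injective (Finₚ.suc-injective (Finₚ.suc-injective eq))))
  joinR-injective ser {zero}        {suc zero}    ()
  joinR-injective ser {zero}        {suc (suc _)} ()
  joinR-injective ser {suc zero}    {zero}        ()
  joinR-injective ser {suc zero}    {suc (suc _)} ()
  joinR-injective ser {suc (suc _)} {zero}        ()
  joinR-injective ser {suc (suc _)} {suc zero}    ()
  joinR-injective par {zero}        {zero}        _  = refl
  joinR-injective par {suc zero}    {suc zero}    _  = refl
  joinR-injective par {suc (suc i)} {suc (suc j)} eq =
    cong (λ i → suc (suc i)) (Finₚ.↑ʳ-injective m₁ i j (Finₚ.suc-injective (Finₚ.suc-injective eq)))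
  joinR-injective par {zero}        {suc zero}    ()
  joinR-injective par {zero}        {suc (suc _)} ()
  joinR-injective par {suc zero}    {zero}        ()
  joinR-injective par {suc zero}    {suc (suc _)} ()
  joinR-injective par {suc (suc _)} {zero}        ()
  joinR-injective par {suc (suc _)} {suc zero}    ()

  joinL≡joinR⇒Overlap : ∀ k {y z} → joinL k m₁ m₂ y ≡ joinR k m₁ m₂ z → Overlap k y z
  joinL≡joinR⇒Overlap ser {suc zero}    {zero}        _  = refl , refl
  joinL≡joinR⇒Overlap ser {suc (suc a)} {suc (suc b)} eq =
    ⊥-elim (↑ˡ≢↑ʳ a b (Finₚ.suc-injective (Finₚ.suc-injective (Finₚ.suc-injective eq))))
  joinL≡joinR⇒Overlap ser {zero}        {zero}        ()
  joinL≡joinR⇒Overlap ser {zero}        {suc zero}    ()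
  joinL≡joinR⇒Overlap ser {zero}        {suc (suc _)} ()
  joinL≡joinR⇒Overlap ser {suc zero}    {suc zero}    ()
  joinL≡joinR⇒Overlap ser {suc zero}    {suc (suc _)} ()
  joinL≡joinR⇒Overlap ser {suc (suc _)} {zero}        ()
  joinL≡joinR⇒Overlap ser {suc (suc _)} {suc zero}    ()
  joinL≡joinR⇒Overlap par {zero}        {zero}        _  = inj₁ (refl , refl)
  joinL≡joinR⇒Overlap par {suc zero}    {suc zero}    _  = inj₂ (refl , refl)
  joinL≡joinR⇒Overlap par {suc (suc a)} {suc (suc b)} eq =
    ⊥-elim (↑ˡ≢↑ʳ a b (Finₚ.suc-injective (Finₚ.suc-injective eq)))
  joinL≡joinR⇒Overlap par {zero}        {suc zero}    ()
  joinL≡joinR⇒Overlap par {zero}        {suc (suc _)} ()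
  joinL≡joinR⇒Overlap par {suc zero}    {zero}        ()
  joinL≡joinR⇒Overlap par {suc zero}    {suc (suc _)} ()
  joinL≡joinR⇒Overlap par {suc (suc _)} {zero}        ()
  joinL≡joinR⇒Overlap par {suc (suc _)} {suc zero}    ()

  joinR≢joinL-Inner : ∀ k {u} → Inner u → ∀ z → joinR k m₁ m₂ z ≢ joinL k m₁ m₂ u
  joinR≢joinL-Inner k inner z eq = proj₁ (Overlap⇒¬Inner k (joinL≡joinR⇒Overlap k (sym eq))) inner

  joinL≢joinR-Inner : ∀ k {u} → Inner u → ∀ y → joinL k m₁ m₂ y ≢ joinR k m₁ m₂ u
  joinL≢joinR-Inner k inner y eq = proj₂ (Overlap⇒¬Inner k (joinL≡joinR⇒Overlap k eq)) inner

  join-cover : ∀ k x → (∃ λ y → joinL k m₁ m₂ y ≡ x) ⊎ (∃ λ z → joinR k m₁ m₂ z ≡ x)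
  join-cover ser zero                = inj₁ (zero , refl)
  join-cover ser (suc zero)          = inj₂ (suc zero , refl)
  join-cover ser (suc (suc zero))    = inj₁ (suc zero , refl)
  join-cover ser (suc (suc (suc j))) with ↑-view m₁ m₂ j
  ... | inj₁ (a , refl) = inj₁ (suc (suc a) , refl)
  ... | inj₂ (b , refl) = inj₂ (suc (suc b) , refl)
  join-cover par zero                = inj₁ (zero , refl)
  join-cover par (suc zero)          = inj₁ (suc zero , refl)
  join-cover par (suc (suc j)) with ↑-view m₁ m₂ j
  ... | inj₁ (a , refl) = inj₁ (suc (suc a) , refl)
  ... | inj₂ (b , refl) = inj₂ (suc (suc b) , refl)

TwoTerminal : ℕ → Set
TwoTerminal m = List (Fin (2 + m) × Fin (2 + m))

net : ∀ {m} → TwoTerminal m → MGraph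
net {m} E = graph (2 + m) E

joinEdges : ∀ k {m₁ m₂} → TwoTerminal m₁ → TwoTerminal m₂ → TwoTerminal (joinSize k m₁ m₂)
joinEdges k {m₁} {m₂} E₁ E₂ = map (mapPair (joinL k m₁ m₂)) E₁ ++ map (mapPair (joinR k m₁ m₂)) E₂

module _ (k : Kind) {m₁ m₂} (E₁ : TwoTerminal m₁) (E₂ : TwoTerminal m₂) where
  private
    J = net (joinEdges k E₁ E₂)
    jL = joinL k m₁ m₂
    jR = joinR k m₁ m₂

  ∈-joinL : ∀ {x y} → (x , y) ∈ₗ E₁ → (jL x , jL y) ∈ₗ joinEdges k E₁ E₂
  ∈-joinL xy = ∈-++⁺ˡ (∈-map⁺ (mapPair jL) xy)

  ∈-joinR : ∀ {x y} → (x , y) ∈ₗ E₂ → (jR x , jR y) ∈ₗ joinEdges k E₁ E₂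
  ∈-joinR xy = ∈-++⁺ʳ (map (mapPair jL) E₁) (∈-map⁺ (mapPair jR) xy)

  Adj-joinL : ∀ {x y} → Adj (net E₁) x y → Adj J (jL x) (jL y)
  Adj-joinL = Data.Sum.map ∈-joinL ∈-joinL

  Adj-joinR : ∀ {x y} → Adj (net E₂) x y → Adj J (jR x) (jR y)
  Adj-joinR = Data.Sum.map ∈-joinR ∈-joinR

  ∈-join⁻ : ∀ {x y} → (x , y) ∈ₗ joinEdges k E₁ E₂ →
    (∃ λ x′ → ∃ λ y′ → (x′ , y′) ∈ₗ E₁ × jL x′ ≡ x × jL y′ ≡ y) ⊎
    (∃ λ x′ → ∃ λ y′ → (x′ , y′) ∈ₗ E₂ × jR x′ ≡ x × jR y′ ≡ y)
  ∈-join⁻ xy with ∈-++⁻ (map (mapPair jL) E₁) xy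
  ... | inj₁ xy₁ with ∈-map⁻ (mapPair jL) xy₁
  ...   | (x′ , y′) , xy′ , eq = inj₁ (x′ , y′ , xy′ , sym (proj₁ (,-injective eq)) , sym (proj₂ (,-injective eq)))
  ∈-join⁻ xy | inj₂ xy₂ with ∈-map⁻ (mapPair jR) xy₂
  ...   | (x′ , y′) , xy′ , eq = inj₂ (x′ , y′ , xy′ , sym (proj₁ (,-injective eq)) , sym (proj₂ (,-injective eq)))

  Adj-join⁻ : ∀ {x y} → Adj J x y →
    (∃ λ x′ → ∃ λ y′ → Adj (net E₁) x′ y′ × jL x′ ≡ x × jL y′ ≡ y) ⊎
    (∃ λ x′ → ∃ λ y′ → Adj (net E₂) x′ y′ × jR x′ ≡ x × jR y′ ≡ y)
  Adj-join⁻ (inj₁ xy) with ∈-join⁻ xy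
  ... | inj₁ (x′ , y′ , xy′ , eqx , eqy) = inj₁ (x′ , y′ , inj₁ xy′ , eqx , eqy)
  ... | inj₂ (x′ , y′ , xy′ , eqx , eqy) = inj₂ (x′ , y′ , inj₁ xy′ , eqx , eqy)
  Adj-join⁻ (inj₂ yx) with ∈-join⁻ yx
  ... | inj₁ (y′ , x′ , yx′ , eqy , eqx) = inj₁ (x′ , y′ , inj₂ yx′ , eqx , eqy)
  ... | inj₂ (y′ , x′ , yx′ , eqy , eqx) = inj₂ (x′ , y′ , inj₂ yx′ , eqx , eqy)

  Conn-joinL : ∀ {S T} → (∀ {x} → x ∉ S → jL x ∉ T) → ∀ {x y} → Conn (net E₁) S x y → Conn J T (jL x) (jL y)
  Conn-joinL = Conn-map jL Adj-joinL

  Conn-joinR : ∀ {S T} → (∀ {x} → x ∉ S → jR x ∉ T) → ∀ {x y} → Conn (net E₂) S x y → Conn J T (jR x) (jR y)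
  Conn-joinR = Conn-map jR Adj-joinR

module _ {a b : ℕ} {f : Fin a → Fin b} where

  ∉⁅⁆-injective : (∀ {x y} → f x ≡ f y → x ≡ y) → ∀ {u x} → x ∉ ⁅ u ⁆ → f x ∉ ⁅ f u ⁆
  ∉⁅⁆-injective inj x∉ = Subsetₚ.x≢y⇒x∉⁅y⁆ (Subsetₚ.x∉⁅y⁆⇒x≢y x∉ ∘ inj)

  ∉⁅⁆-preimage : ∀ {u x} → f x ∉ ⁅ f u ⁆ → x ∉ ⁅ u ⁆
  ∉⁅⁆-preimage {u} {x} fx∉ x∈ =
    fx∉ (subst (λ v → f x ∈ ⁅ f v ⁆) (Subsetₚ.x∈⁅y⁆⇒x≡y u x∈) (Subsetₚ.x∈⁅x⁆ (f x)))

  ∉⁅⁆-missed : ∀ {u} → (∀ y → f y ≢ u) → ∀ {x} → f x ∉ ⁅ u ⁆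
  ∉⁅⁆-missed missed = Subsetₚ.x≢y⇒x∉⁅y⁆ (missed _)

-- Connectivity of series–parallel graphs

Connected : ∀ {m} → TwoTerminal m → Set
Connected E = ∀ x → Conn (net E) ∅ x zero

ReachesTerminal : ∀ {m} → TwoTerminal m → Fin (2 + m) → Fin (2 + m) → Set
ReachesTerminal E u x = Conn (net E) ⁅ u ⁆ x zero ⊎ Conn (net E) ⁅ u ⁆ x (suc zero)

-- for u = s (u = t) this says that G - u is connected
ReachTerminals : ∀ {m} → TwoTerminal m → Set
ReachTerminals E = ∀ {u x} → x ≢ u → ReachesTerminal E u x

join-Connected : ∀ k {m₁ m₂} {E₁ : TwoTerminal m₁} {E₂ : TwoTerminal m₂} →
                 Connected E₁ → Connected E₂ → Connected (joinEdges k E₁ E₂)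
join-Connected k {m₁} {m₂} {E₁} {E₂} conn₁ conn₂ x with join-cover k x
... | inj₁ (y , refl) = subst (Conn _ ∅ _) (joinL-s k) (liftL (conn₁ y))
  where liftL = Conn-joinL k E₁ E₂ (λ _ → Subsetₚ.∉⊥)
... | inj₂ (z , refl) = Conn-trans (subst (Conn _ ∅ _) (joinR-s k) (liftR (conn₂ z)))
                                   (subst (Conn _ ∅ _) (joinL-s k) (liftL (conn₁ (glued k))))
  where liftL = Conn-joinL k E₁ E₂ (λ _ → Subsetₚ.∉⊥)
        liftR = Conn-joinR k E₁ E₂ (λ _ → Subsetₚ.∉⊥)

module _ {m₁ m₂} {E₁ : TwoTerminal m₁} {E₂ : TwoTerminal m₂} where

  -- a walk that reached the glued terminal continues through the other part
  left-t-reaches : ∀ k → Connected E₂ → ∀ {u x} → suc zero ∉ ⁅ u ⁆ →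
    Conn (net (joinEdges k E₁ E₂)) ⁅ joinL k m₁ m₂ u ⁆ x (joinL k m₁ m₂ (suc zero)) →
    ReachesTerminal (joinEdges k E₁ E₂) (joinL k m₁ m₂ u) x
  left-t-reaches par conn₂ t∉ p = inj₂ p
  left-t-reaches ser conn₂ {u} t∉ p = inj₂ (Conn-trans p (Conn-joinR ser E₁ E₂ avoid (Conn-sym (conn₂ (suc zero)))))
    where
    avoid : ∀ {z} → z ∉ ∅ → joinR ser m₁ m₂ z ∉ ⁅ joinL ser m₁ m₂ u ⁆
    avoid _ = ∉⁅⁆-missed {f = joinR ser m₁ m₂} λ z eq →
      t∉ (subst (_∈ ⁅ u ⁆) (proj₁ (joinL≡joinR⇒Overlap ser (sym eq))) (Subsetₚ.x∈⁅x⁆ u))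

  right-s-reaches : ∀ k → Connected E₁ → ∀ {u x} → zero ∉ ⁅ u ⁆ →
    Conn (net (joinEdges k E₁ E₂)) ⁅ joinR k m₁ m₂ u ⁆ x (joinR k m₁ m₂ zero) →
    ReachesTerminal (joinEdges k E₁ E₂) (joinR k m₁ m₂ u) x
  right-s-reaches par conn₁ s∉ p = inj₁ p
  right-s-reaches ser conn₁ {u} s∉ p = inj₁ (Conn-trans p (Conn-joinL ser E₁ E₂ avoid (conn₁ (suc zero))))
    where
    avoid : ∀ {y} → y ∉ ∅ → joinL ser m₁ m₂ y ∉ ⁅ joinR ser m₁ m₂ u ⁆
    avoid _ = ∉⁅⁆-missed {f = joinL ser m₁ m₂} λ y eq →
      s∉ (subst (_∈ ⁅ u ⁆) (proj₂ (joinL≡joinR⇒Overlap ser eq)) (Subsetₚ.x∈⁅x⁆ u))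

  join-ReachTerminals : ∀ k → Connected E₁ → ReachTerminals E₁ → Connected E₂ → ReachTerminals E₂ →
                        ReachTerminals (joinEdges k E₁ E₂)
  join-ReachTerminals k conn₁ reach₁ conn₂ reach₂ {u} {x} x≢u with join-cover k x
  ... | inj₁ (y , refl) with Finₚ.any? (λ u′ → joinL k m₁ m₂ u′ ≟ u)
  ...   | yes (u′ , refl) = by-cases (reach₁ (x≢u ∘ cong (joinL k m₁ m₂)))
    where
    by-cases : ReachesTerminal E₁ u′ y → ReachesTerminal (joinEdges k E₁ E₂) (joinL k m₁ m₂ u′) (joinL k m₁ m₂ y)
    by-cases (inj₁ p) = inj₁ (subst (Conn _ _ _) (joinL-s k) (Conn-joinL k E₁ E₂ (∉⁅⁆-injective (joinL-injective k)) p))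
    by-cases (inj₂ p) = left-t-reaches k conn₂ (Conn-end p) (Conn-joinL k E₁ E₂ (∉⁅⁆-injective (joinL-injective k)) p)
  ...   | no missed = inj₁ (subst (Conn _ _ _) (joinL-s k)
                        (Conn-joinL k E₁ E₂ (λ _ → ∉⁅⁆-missed (curry missed)) (conn₁ y)))
  join-ReachTerminals k conn₁ reach₁ conn₂ reach₂ {u} {x} x≢u | inj₂ (z , refl)
    with Finₚ.any? (λ u′ → joinR k m₁ m₂ u′ ≟ u)
  ...   | yes (u′ , refl) = by-cases (reach₂ (x≢u ∘ cong (joinR k m₁ m₂)))
    where
    by-cases : ReachesTerminal E₂ u′ z → ReachesTerminal (joinEdges k E₁ E₂) (joinR k m₁ m₂ u′) (joinR k m₁ m₂ z)
    by-cases (inj₁ p) = right-s-reaches k conn₁ (Conn-end p) (Conn-joinR k E₁ E₂ (∉⁅⁆-injective (joinR-injective k)) p)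
    by-cases (inj₂ p) = inj₂ (subst (Conn _ _ _) (joinR-t k) (Conn-joinR k E₁ E₂ (∉⁅⁆-injective (joinR-injective k)) p))
  ...   | no missed = inj₂ (subst (Conn _ _ _) (joinR-t k)
                        (Conn-joinR k E₁ E₂ (λ _ → ∉⁅⁆-missed (curry missed))
                          (Conn-trans (conn₂ z) (Conn-sym (conn₂ (suc zero))))))

module _ (P : ∀ {m} → TwoTerminal m → Set) (P-leaf : P (edgesOf leaf))
         (P-join : ∀ k {m₁ m₂} {E₁ : TwoTerminal m₁} {E₂ : TwoTerminal m₂} →
                   P E₁ → P E₂ → P (joinEdges k E₁ E₂))
         where

  mutual
    sp-induction : ∀ T → WF T → P (edgesOf T)
    sp-induction leaf              _         = P-leaf
    sp-induction (node k [])       (() , _)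
    sp-induction (node k (c ∷ cs)) (_ , wfs) = sp-induction-children k c cs wfs

    sp-induction-children : ∀ k c cs → AllWF k (c ∷ cs) → P (edgesList k (c ∷ cs))
    sp-induction-children k c []        (_ , wf , _)   = sp-induction c wf
    sp-induction-children k c (c′ ∷ cs) (_ , wf , wfs) = P-join k (sp-induction c wf) (sp-induction-children k c′ cs wfs)

ConnectedReaching : ∀ {m} → TwoTerminal m → Set
ConnectedReaching E = Connected E × ReachTerminals E

edge-ConnectedReaching : ConnectedReaching (edgesOf leaf)
edge-ConnectedReaching = connected , reaches
  where
  connected : Connected (edgesOf leaf)
  connected zero       = conn-refl Subsetₚ.∉⊥
  connected (suc zero) = Conn-edge Subsetₚ.∉⊥ (inj₂ (here refl)) Subsetₚ.∉⊥
  reaches : ReachTerminals (edgesOf leaf)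
  reaches {x = zero}     x≢u = inj₁ (conn-refl (Subsetₚ.x≢y⇒x∉⁅y⁆ x≢u))
  reaches {x = suc zero} x≢u = inj₂ (conn-refl (Subsetₚ.x≢y⇒x∉⁅y⁆ x≢u))

join-ConnectedReaching : ∀ k {m₁ m₂} {E₁ : TwoTerminal m₁} {E₂ : TwoTerminal m₂} →
  ConnectedReaching E₁ → ConnectedReaching E₂ → ConnectedReaching (joinEdges k E₁ E₂)
join-ConnectedReaching k (conn₁ , reach₁) (conn₂ , reach₂) =
  join-Connected k conn₁ conn₂ , join-ReachTerminals k conn₁ reach₁ conn₂ reach₂

sp-connected : ∀ T → WF T → Connected (edgesOf T)
sp-connected T wf = proj₁ (sp-induction ConnectedReaching edge-ConnectedReaching join-ConnectedReaching T wf)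

sp-children-connected : ∀ k c cs → AllWF k (c ∷ cs) → Connected (edgesList k (c ∷ cs))
sp-children-connected k c cs wfs =
  proj₁ (sp-induction-children ConnectedReaching edge-ConnectedReaching join-ConnectedReaching k c cs wfs)

sp-reach-terminals : ∀ T → WF T → ReachTerminals (edgesOf T)
sp-reach-terminals T wf = proj₂ (sp-induction ConnectedReaching edge-ConnectedReaching join-ConnectedReaching T wf)

without-s-reaches-t : ∀ {m} {E : TwoTerminal m} → ReachTerminals E → ∀ {x} → x ≢ zero → Conn (net E) ⁅ zero ⁆ x (suc zero)
without-s-reaches-t reach x≢s with reach x≢s
... | inj₁ to-s = ⊥-elim (Conn-end to-s (Subsetₚ.x∈⁅x⁆ zero))
... | inj₂ to-t = to-t

-- E₁ sits inside E₂ attached only at its terminals, so inner vertices keep their neighbourhoods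
record Subnetwork {m₁ m₂} (E₁ : TwoTerminal m₁) (E₂ : TwoTerminal m₂) : Set where
  field
    embed           : Fin (2 + m₁) → Fin (2 + m₂)
    embed-∈         : ∀ {x y} → (x , y) ∈ₗ E₁ → (embed x , embed y) ∈ₗ E₂
    embed-injective : ∀ {x y} → embed x ≡ embed y → x ≡ y
    embed-Inner     : ∀ {x} → Inner x → Inner (embed x)
    embed-nbrs      : ∀ {x y} → Inner x → Adj (net E₂) (embed x) y → ∃ λ y′ → Adj (net E₁) x y′ × embed y′ ≡ y

  embed-Adj : ∀ {x y} → Adj (net E₁) x y → Adj (net E₂) (embed x) (embed y)
  embed-Adj = Data.Sum.map embed-∈ embed-∈

open Subnetwork

id-subnetwork : ∀ {m} {E : TwoTerminal m} → Subnetwork E E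
id-subnetwork = record
  { embed = id ; embed-∈ = id ; embed-injective = id ; embed-Inner = id ; embed-nbrs = λ _ xy → _ , xy , refl }

_∘ₛ_ : ∀ {m₁ m₂ m₃} {E₁ : TwoTerminal m₁} {E₂ : TwoTerminal m₂} {E₃ : TwoTerminal m₃} →
       Subnetwork E₂ E₃ → Subnetwork E₁ E₂ → Subnetwork E₁ E₃
N ∘ₛ M = record
  { embed           = embed N ∘ embed M
  ; embed-∈         = embed-∈ N ∘ embed-∈ M
  ; embed-injective = embed-injective M ∘ embed-injective N
  ; embed-Inner     = embed-Inner N ∘ embed-Inner M
  ; embed-nbrs      = nbrs
  }
  where
  nbrs : ∀ {x y} → Inner x → Adj _ (embed N (embed M x)) y → ∃ λ y′ → Adj _ x y′ × embed N (embed M y′) ≡ y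
  nbrs inner xy with embed-nbrs N (embed-Inner M inner) xy
  ... | y₁ , xy₁ , refl with embed-nbrs M inner xy₁
  ...   | y₂ , xy₂ , refl = y₂ , xy₂ , refl

module _ (k : Kind) {m₁ m₂} (E₁ : TwoTerminal m₁) (E₂ : TwoTerminal m₂) where

  left-subnetwork : Subnetwork E₁ (joinEdges k E₁ E₂)
  left-subnetwork = record
    { embed = joinL k m₁ m₂ ; embed-∈ = ∈-joinL k E₁ E₂ ; embed-injective = joinL-injective k
    ; embed-Inner = joinL-Inner k ; embed-nbrs = nbrs }
    where
    nbrs : ∀ {x y} → Inner x → Adj _ (joinL k m₁ m₂ x) y → ∃ λ y′ → Adj _ x y′ × joinL k m₁ m₂ y′ ≡ y
    nbrs inner xy with Adj-join⁻ k E₁ E₂ xy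
    ... | inj₁ (x′ , y′ , x′y′ , eq , refl) with joinL-injective k eq
    ...   | refl = y′ , x′y′ , refl
    nbrs inner xy | inj₂ (x′ , _ , _ , eq , _) = ⊥-elim (joinR≢joinL-Inner k inner x′ eq)

  right-subnetwork : Subnetwork E₂ (joinEdges k E₁ E₂)
  right-subnetwork = record
    { embed = joinR k m₁ m₂ ; embed-∈ = ∈-joinR k E₁ E₂ ; embed-injective = joinR-injective k
    ; embed-Inner = joinR-Inner k ; embed-nbrs = nbrs }
    where
    nbrs : ∀ {x y} → Inner x → Adj _ (joinR k m₁ m₂ x) y → ∃ λ y′ → Adj _ x y′ × joinR k m₁ m₂ y′ ≡ y
    nbrs inner xy with Adj-join⁻ k E₁ E₂ xy
    ... | inj₂ (x′ , y′ , x′y′ , eq , refl) with joinR-injective k eq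
    ...   | refl = y′ , x′y′ , refl
    nbrs inner xy | inj₁ (x′ , _ , _ , eq , _) = ⊥-elim (joinL≢joinR-Inner k inner x′ eq)

child-subnetwork : ∀ k cs i → Subnetwork (edgesOf (lookup cs i)) (edgesList k cs)
child-subnetwork k (c ∷ [])      zero    = id-subnetwork
child-subnetwork k (c ∷ c′ ∷ cs) zero    = left-subnetwork k (edgesOf c) (edgesList k (c′ ∷ cs))
child-subnetwork k (c ∷ c′ ∷ cs) (suc i) =
  right-subnetwork k (edgesOf c) (edgesList k (c′ ∷ cs)) ∘ₛ child-subnetwork k (c′ ∷ cs) i

node-subnetwork : ∀ T p → Subnetwork (edgesOf (subAt T p)) (edgesOf T)
node-subnetwork T           root        = id-subnetwork
node-subnetwork (node k cs) (child i p) = child-subnetwork k cs i ∘ₛ node-subnetwork (lookup cs i) p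


ConnectedWithout : ∀ {m} → TwoTerminal m → Fin (2 + m) → Set
ConnectedWithout E u = ∀ {x y} → x ≢ u → y ≢ u → Conn (net E) ⁅ u ⁆ x y

via-hub : ∀ {m} {E : TwoTerminal m} {u h} → (∀ {x} → x ≢ u → Conn (net E) ⁅ u ⁆ x h) → ConnectedWithout E u
via-hub to-hub x≢u y≢u = Conn-trans (to-hub x≢u) (Conn-sym (to-hub y≢u))

module _ (k : Kind) {m₁ m₂} {E₁ : TwoTerminal m₁} {E₂ : TwoTerminal m₂} where

  join-ConnectedWithoutˡ : ∀ {u} → Inner u → Connected E₂ → ConnectedWithout E₁ u →
                           ConnectedWithout (joinEdges k E₁ E₂) (joinL k m₁ m₂ u)
  join-ConnectedWithoutˡ {u} inner conn₂ conn₁-u = via-hub to-s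
    where
    s≢u = Inner⇒≢s inner ∘ sym
    lift = Conn-joinL k E₁ E₂ (∉⁅⁆-injective (joinL-injective k))
    avoid : ∀ {z} → z ∉ ∅ → joinR k m₁ m₂ z ∉ ⁅ joinL k m₁ m₂ u ⁆
    avoid _ = ∉⁅⁆-missed (joinR≢joinL-Inner k inner)
    to-s : ∀ {x} → x ≢ joinL k m₁ m₂ u → Conn _ ⁅ joinL k m₁ m₂ u ⁆ x zero
    to-s {x} x≢u with join-cover k x
    ... | inj₁ (y , refl) = subst (Conn _ _ _) (joinL-s k) (lift (conn₁-u (x≢u ∘ cong (joinL k m₁ m₂)) s≢u))
    ... | inj₂ (z , refl) = Conn-trans (subst (Conn _ _ _) (joinR-s k) (Conn-joinR k E₁ E₂ avoid (conn₂ z)))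
        (subst (Conn _ _ _) (joinL-s k) (lift (conn₁-u (glued≢Inner k inner) s≢u)))

  join-ConnectedWithoutʳ : ∀ {u} → Inner u → Connected E₁ → ConnectedWithout E₂ u →
                           ConnectedWithout (joinEdges k E₁ E₂) (joinR k m₁ m₂ u)
  join-ConnectedWithoutʳ {u} inner conn₁ conn₂-u = via-hub to-t
    where
    t≢u = Inner⇒≢t inner ∘ sym
    lift = Conn-joinR k E₁ E₂ (∉⁅⁆-injective (joinR-injective k))
    avoid : ∀ {y} → y ∉ ∅ → joinL k m₁ m₂ y ∉ ⁅ joinR k m₁ m₂ u ⁆
    avoid _ = ∉⁅⁆-missed (joinL≢joinR-Inner k inner)
    to-t : ∀ {x} → x ≢ joinR k m₁ m₂ u → Conn _ ⁅ joinR k m₁ m₂ u ⁆ x (suc zero)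
    to-t {x} x≢u with join-cover k x
    ... | inj₂ (z , refl) = subst (Conn _ _ _) (joinR-t k) (lift (conn₂-u (x≢u ∘ cong (joinR k m₁ m₂)) t≢u))
    ... | inj₁ (y , refl) = Conn-trans
        (subst (Conn _ _ _) (sym (joinR-s k)) (Conn-joinL k E₁ E₂ avoid (Conn-trans (conn₁ y) (Conn-sym (conn₁ (glued k))))))
        (subst (Conn _ _ _) (joinR-t k) (lift (conn₂-u (Inner⇒≢s inner ∘ sym) t≢u)))

child-ConnectedWithout : ∀ k cs i → AllWF k cs → ∀ {u} → Inner u → ConnectedWithout (edgesOf (lookup cs i)) u →
                         ConnectedWithout (edgesList k cs) (embed (child-subnetwork k cs i) u)
child-ConnectedWithout k (c ∷ [])      zero    _              _     c-u = c-u
child-ConnectedWithout k (c ∷ c′ ∷ cs) zero    (_ , _ , wfs)  inner c-u =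
  join-ConnectedWithoutˡ k inner (sp-children-connected k c′ cs wfs) c-u
child-ConnectedWithout k (c ∷ c′ ∷ cs) (suc i) (_ , wf , wfs) inner c-u =
  join-ConnectedWithoutʳ k (embed-Inner (child-subnetwork k (c′ ∷ cs) i) inner) (sp-connected c wf)
    (child-ConnectedWithout k (c′ ∷ cs) i wfs inner c-u)

-- the other children of a parallel node join its terminals
parallel-terminals-joined : ∀ c c′ cs → AllWF par (c ∷ c′ ∷ cs) → ∀ i {u} → Inner u →
  Conn (net (edgesList par (c ∷ c′ ∷ cs))) ⁅ embed (child-subnetwork par (c ∷ c′ ∷ cs) i) u ⁆ (suc zero) zero
parallel-terminals-joined c c′ cs (_ , _ , wfs) zero {u} inner =
  Conn-joinR par (edgesOf c) _ (λ _ → ∉⁅⁆-missed (joinR≢joinL-Inner par inner))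
    (sp-children-connected par c′ cs wfs (suc zero))
parallel-terminals-joined c c′ cs (_ , wf , wfs) (suc i) {u} inner =
  Conn-joinL par (edgesOf c) _
    (λ _ → ∉⁅⁆-missed (joinL≢joinR-Inner par (embed-Inner (child-subnetwork par (c′ ∷ cs) i) inner)))
    (sp-connected c wf (suc zero))

parallel-child-ConnectedWithout : ∀ cs → WF (node par cs) → ∀ i {u} → Inner u →
                                  ConnectedWithout (edgesList par cs) (embed (child-subnetwork par cs i) u)
parallel-child-ConnectedWithout []            (() , _)
parallel-child-ConnectedWithout (c ∷ [])      (ℕ.s≤s () , _)
parallel-child-ConnectedWithout (c ∷ c′ ∷ cs) wf@(_ , wfs) i inner = via-hub to-s
  where
  to-s : ∀ {x} → x ≢ embed (child-subnetwork par (c ∷ c′ ∷ cs) i) _ → Conn _ _ x zero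
  to-s x≢u with sp-reach-terminals (node par (c ∷ c′ ∷ cs)) wf x≢u
  ... | inj₁ to-s = to-s
  ... | inj₂ to-t = Conn-trans to-t (parallel-terminals-joined c c′ cs wfs i inner)

AllWF-lookup : ∀ k cs → AllWF k cs → ∀ i → ChildOK k (lookup cs i) × WF (lookup cs i)
AllWF-lookup k (c ∷ cs) (ok , wf , _)   zero    = ok , wf
AllWF-lookup k (c ∷ cs) (_ , _ , wfs)   (suc i) = AllWF-lookup k cs wfs i

NonRoot : ∀ {T} → Pos T → Set
NonRoot root        = ⊥
NonRoot (child _ _) = ⊤

root-or-NonRoot : ∀ {T} (p : Pos T) → p ≡ root ⊎ NonRoot p
root-or-NonRoot root        = inj₁ refl
root-or-NonRoot (child _ _) = inj₂ tt

IsSeries : SPT → Set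
IsSeries X = ∃ λ cs → X ≡ node ser cs

series-child-ConnectedWithout : ∀ k cs → WF (node k cs) → ∀ i → IsSeries (lookup cs i) →
  ∀ {u} → Inner u → ConnectedWithout (edgesList k cs) (embed (child-subnetwork k cs i) u)
series-child-ConnectedWithout ser cs (_ , wfs) i (_ , eq)
  with () ← subst (ChildOK ser) eq (proj₁ (AllWF-lookup ser cs wfs i)) refl
series-child-ConnectedWithout par cs wf        i _        = parallel-child-ConnectedWithout cs wf i

-- the parent of a non-root series node is a parallel node, whose other children reconnect its terminals
series-node-ConnectedWithout : ∀ T (p : Pos T) → NonRoot p → WF T → IsSeries (subAt T p) →
  ∀ {u} → Inner u → ConnectedWithout (edgesOf T) (embed (node-subnetwork T p) u)
series-node-ConnectedWithout (node k cs) (child i q) _ wf@(_ , wfs) series inner with root-or-NonRoot q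
... | inj₁ refl    = series-child-ConnectedWithout k cs wf i series inner
... | inj₂ nonroot = child-ConnectedWithout k cs i wfs (embed-Inner (node-subnetwork (lookup cs i) q) inner)
                       (series-node-ConnectedWithout (lookup cs i) q nonroot (proj₂ (AllWF-lookup k cs wfs i)) series inner)

-- The substructure R_{2,1}

-- neighbours computes on concrete edge lists, which turns neighbourhoods into finite case splits
neighbours : ∀ {V} → List (Fin V × Fin V) → Fin V → List (Fin V)
neighbours E u = map proj₂ (filter (λ e → proj₁ e ≟ u) E) ++ map proj₁ (filter (λ e → proj₂ e ≟ u) E)

Adj⇒∈neighbours : ∀ {V} {E : List (Fin V × Fin V)} {u y} → Adj (graph V E) u y → y ∈ₗ neighbours E u
Adj⇒∈neighbours {E = E} {u} (inj₁ uy) = ∈-++⁺ˡ (∈-map⁺ proj₂ (∈-filter⁺ (λ e → proj₁ e ≟ u) uy refl))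
Adj⇒∈neighbours {E = E} {u} (inj₂ yu) =
  ∈-++⁺ʳ (map proj₂ (filter (λ e → proj₁ e ≟ u) E)) (∈-map⁺ proj₁ (∈-filter⁺ (λ e → proj₂ e ≟ u) yu refl))

first-child-s : ∀ k c cs → embed (child-subnetwork k (c ∷ cs) zero) zero ≡ zero
first-child-s k c []       = refl
first-child-s k c (_ ∷ _) = joinL-s k

series-s-neighbours : ∀ c cs {y} → Adj (net (edgesList ser (c ∷ cs))) zero y →
                      ∃ λ y′ → Adj (net (edgesOf c)) zero y′ × embed (child-subnetwork ser (c ∷ cs) zero) y′ ≡ y
series-s-neighbours c []        sy = _ , sy , refl
series-s-neighbours c (c′ ∷ cs) sy with Adj-join⁻ ser (edgesOf c) (edgesList ser (c′ ∷ cs)) sy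
... | inj₁ (x′ , y′ , x′y′ , eq , refl) with joinL-injective ser {x′} {zero} eq
...   | refl = y′ , x′y′ , refl
series-s-neighbours c (c′ ∷ cs) sy | inj₂ (x′ , _ , _ , eq , _)
  with () ← proj₁ (joinL≡joinR⇒Overlap ser {zero} {x′} (sym eq))

R21 : List SPT → List SPT → SPT
R21 pre post = node ser (R21Children pre post)

record R21Structure {m} (E : TwoTerminal m) : Set where
  field
    s₁ t₁ v₁ v₂ t₂ : Fin (2 + m)
    s₁v₁∈  : (s₁ , v₁) ∈ₗ E
    v₁t₁∈  : (v₁ , t₁) ∈ₗ E
    s₁~v₂  : Adj (net E) s₁ v₂
    v₂~t₁  : Adj (net E) v₂ t₁
    t₁~t₂  : Adj (net E) t₁ t₂
    N[v₂]  : ∀ {y} → Adj (net E) v₂ y → y ≡ s₁ ⊎ y ≡ t₁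
    N[t₁]  : ∀ {y} → Adj (net E) t₁ y → y ≡ v₁ ⊎ y ≡ v₂ ⊎ y ≡ t₂
    t₁-Inner : Inner t₁
    v₂-Inner : Inner v₂
    s₁≢t₁  : s₁ ≢ t₁
    s₁≢v₂  : s₁ ≢ v₂
    v₁≢v₂  : v₁ ≢ v₂

  v₁~t₁ : Adj (net E) v₁ t₁
  v₁~t₁ = inj₁ v₁t₁∈

R21Structure-embed : ∀ {m m′} {E : TwoTerminal m} {E′ : TwoTerminal m′} → Subnetwork E E′ → R21Structure E → R21Structure E′
R21Structure-embed ι R = record
  { s₁ = ⟨ s₁ ⟩ ; t₁ = ⟨ t₁ ⟩ ; v₁ = ⟨ v₁ ⟩ ; v₂ = ⟨ v₂ ⟩ ; t₂ = ⟨ t₂ ⟩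
  ; s₁v₁∈ = embed-∈ ι s₁v₁∈ ; v₁t₁∈ = embed-∈ ι v₁t₁∈
  ; s₁~v₂ = embed-Adj ι s₁~v₂ ; v₂~t₁ = embed-Adj ι v₂~t₁ ; t₁~t₂ = embed-Adj ι t₁~t₂
  ; N[v₂] = λ v₂y → let _ , v₂y′ , eq = embed-nbrs ι v₂-Inner v₂y in Data.Sum.map (mapped eq) (mapped eq) (N[v₂] v₂y′)
  ; N[t₁] = λ t₁y → let _ , t₁y′ , eq = embed-nbrs ι t₁-Inner t₁y in
                    Data.Sum.map (mapped eq) (Data.Sum.map (mapped eq) (mapped eq)) (N[t₁] t₁y′)
  ; t₁-Inner = embed-Inner ι t₁-Inner ; v₂-Inner = embed-Inner ι v₂-Inner
  ; s₁≢t₁ = s₁≢t₁ ∘ embed-injective ι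
  ; s₁≢v₂ = s₁≢v₂ ∘ embed-injective ι
  ; v₁≢v₂ = v₁≢v₂ ∘ embed-injective ι
  }
  where
  open R21Structure R
  ⟨_⟩ = embed ι
  mapped : ∀ {x y′ y} → ⟨ y′ ⟩ ≡ y → y′ ≡ x → y ≡ ⟨ x ⟩
  mapped eq refl = sym eq

R₂-neighbours-s : ∀ {y} → Adj (net (edgesOf R₂)) zero y → y ≡ suc (suc zero) ⊎ y ≡ suc (suc (suc zero))
R₂-neighbours-s sy with Adj⇒∈neighbours sy
... | here refl         = inj₁ refl
... | there (here refl) = inj₂ refl

R₂-neighbours-t : ∀ {y} → Adj (net (edgesOf R₂)) (suc zero) y → y ≡ suc (suc zero) ⊎ y ≡ suc (suc (suc zero))
R₂-neighbours-t ty with Adj⇒∈neighbours ty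
... | here refl         = inj₁ refl
... | there (here refl) = inj₂ refl

R₂-neighbours-v₂ : ∀ {y} → Adj (net (edgesOf R₂)) (suc (suc (suc zero))) y → y ≡ zero ⊎ y ≡ suc zero
R₂-neighbours-v₂ v₂y with Adj⇒∈neighbours v₂y
... | here refl         = inj₂ refl
... | there (here refl) = inj₁ refl

edge-neighbours-s : ∀ {y} → Adj (net (edgesOf leaf)) zero y → y ≡ suc zero
edge-neighbours-s sy with Adj⇒∈neighbours sy
... | here refl = refl

-- In R₂ the 4-cycle s₁ v₁ t₁ v₂ is 0 2 1 3; the edge t₁ t₂ is the first child of leaf ∷ post.
module R21Base (post : List SPT) where
  private
    m    = innerList ser (leaf ∷ post)
    E    = edgesOf (R21 [] post)
    jL   = joinL ser 2 m
    jR   = joinR ser 2 m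
    rest = child-subnetwork ser (leaf ∷ post) zero

  s₁ t₁ v₁ v₂ t₂ : Fin (2 + inner (R21 [] post))
  s₁ = jL zero
  t₁ = jL (suc zero)
  v₁ = jL (suc (suc zero))
  v₂ = jL (suc (suc (suc zero)))
  t₂ = jR (embed rest (suc zero))

  t₁~t₂ : Adj (net E) t₁ t₂
  t₁~t₂ = inj₁ (∈-joinR ser (edgesOf R₂) _ (subst (λ x → (x , embed rest (suc zero)) ∈ₗ edgesList ser (leaf ∷ post))
                                                     (first-child-s ser leaf post) (embed-∈ rest (here refl))))

  N[v₂] : ∀ {y} → Adj (net E) v₂ y → y ≡ s₁ ⊎ y ≡ t₁
  N[v₂] v₂y with embed-nbrs (left-subnetwork ser (edgesOf R₂) _) tt v₂y
  ... | _ , v₂y′ , refl with R₂-neighbours-v₂ v₂y′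
  ...   | inj₁ refl = inj₁ refl
  ...   | inj₂ refl = inj₂ refl

  N[t₁] : ∀ {y} → Adj (net E) t₁ y → y ≡ v₁ ⊎ y ≡ v₂ ⊎ y ≡ t₂
  N[t₁] t₁y with Adj-join⁻ ser (edgesOf R₂) _ t₁y
  ... | inj₁ (x′ , y′ , x′y′ , eq , refl) with joinL-injective ser {x′} {suc zero} eq
  ...   | refl with R₂-neighbours-t x′y′
  ...     | inj₁ refl = inj₁ refl
  ...     | inj₂ refl = inj₂ (inj₁ refl)
  N[t₁] t₁y | inj₂ (x′ , y′ , x′y′ , eq , refl) with proj₂ (joinL≡joinR⇒Overlap ser {suc zero} {x′} (sym eq))
  ...   | refl with series-s-neighbours leaf post x′y′
  ...     | _ , sy″ , refl with edge-neighbours-s sy″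
  ...       | refl = inj₂ (inj₂ refl)

  N[s₁] : ∀ {y} → Adj (net E) s₁ y → y ≡ v₁ ⊎ y ≡ v₂
  N[s₁] s₁y with series-s-neighbours R₂ (leaf ∷ post) s₁y
  ... | _ , sy′ , refl with R₂-neighbours-s sy′
  ...   | inj₁ refl = inj₁ refl
  ...   | inj₂ refl = inj₂ refl

  structure : R21Structure E
  structure = record
    { s₁ = s₁ ; t₁ = t₁ ; v₁ = v₁ ; v₂ = v₂ ; t₂ = t₂
    ; s₁v₁∈ = ∈-joinL ser (edgesOf R₂) _ (here refl)
    ; v₁t₁∈ = ∈-joinL ser (edgesOf R₂) _ (there (here refl))
    ; s₁~v₂ = inj₁ (∈-joinL ser (edgesOf R₂) _ (there (there (here refl))))
    ; v₂~t₁ = inj₁ (∈-joinL ser (edgesOf R₂) _ (there (there (there (here refl)))))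
    ; t₁~t₂ = t₁~t₂ ; N[v₂] = N[v₂] ; N[t₁] = N[t₁]
    ; t₁-Inner = tt ; v₂-Inner = tt
    ; s₁≢t₁ = λ () ; s₁≢v₂ = λ () ; v₁≢v₂ = λ ()
    }

suffix-subnetwork : ∀ k pre c cs → Subnetwork (edgesList k (c ∷ cs)) (edgesList k (pre ++ c ∷ cs))
suffix-subnetwork k []             c cs = id-subnetwork
suffix-subnetwork k (d ∷ [])       c cs = right-subnetwork k (edgesOf d) (edgesList k (c ∷ cs))
suffix-subnetwork k (d ∷ d′ ∷ pre) c cs =
  right-subnetwork k (edgesOf d) (edgesList k (d′ ∷ pre ++ c ∷ cs)) ∘ₛ suffix-subnetwork k (d′ ∷ pre) c cs

R21Structure⇒RemovableEdge : ∀ {m} {E : TwoTerminal m} (R : R21Structure E) →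
                             ConnectedWithout E (R21Structure.t₁ R) → RemovableEdge (net E)
R21Structure⇒RemovableEdge R t₁-noncut = record
  { e = Any.index s₁v₁∈ ; a = s₁ ; v = v₁ ; b = t₁ ; w = v₂ ; z = t₂
  ; e-joins = ∈⇒Joins s₁v₁∈
  ; v~b = v₁~t₁ ; a~w = s₁~v₂ ; w~b = v₂~t₁ ; b~z = t₁~t₂
  ; N[w] = N[v₂] ; N[b] = N[t₁]
  ; a≢b = s₁≢t₁ ; a≢w = s₁≢v₂ ; v≢w = v₁≢v₂
  ; G-b-connected = λ x≢t₁ → t₁-noncut x≢t₁ s₁≢t₁
  }
  where open R21Structure R

nonroot-R21-RemovableEdge : ∀ T (p : Pos T) → NonRoot p → WF T → ∀ pre post →
                            subAt T p ≡ R21 pre post → RemovableEdge (graphOf T)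
nonroot-R21-RemovableEdge T p nonroot wf pre post eq =
  at (subAt T p) eq (node-subnetwork T p) (series-node-ConnectedWithout T p nonroot wf (_ , eq))
  where
  -- abstracting subAt T p lets eq be matched
  at : ∀ X → X ≡ R21 pre post → (ι : Subnetwork (edgesOf X) (edgesOf T)) →
       (∀ {u} → Inner u → ConnectedWithout (edgesOf T) (embed ι u)) → RemovableEdge (graphOf T)
  at _ refl ι noncut =
    R21Structure⇒RemovableEdge (R21Structure-embed ι′ (R21Base.structure post)) (noncut (embed-Inner suffix tt))
    where
    suffix = suffix-subnetwork ser pre R₂ (leaf ∷ post)
    ι′ = ι ∘ₛ suffix

-- here s₁ = s has degree two, so the roles of s₁ and t₁ are swapped
first-R21-RemovableEdge : ∀ post → WF (R21 [] post) → RemovableEdge (graphOf (R21 [] post))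
first-R21-RemovableEdge post wf = record
  { e = Any.index v₁t₁∈ ; a = t₁ ; v = v₁ ; b = s₁ ; w = v₂ ; z = v₁
  ; e-joins = Data.Sum.swap (∈⇒Joins v₁t₁∈)
  ; v~b = inj₂ s₁v₁∈ ; a~w = Adj-sym G v₂~t₁ ; w~b = Adj-sym G s₁~v₂ ; b~z = inj₁ s₁v₁∈
  ; N[w] = Data.Sum.swap ∘ N[v₂] ; N[b] = Data.Sum.map₂ inj₁ ∘ N[s₁]
  ; a≢b = λ () ; a≢w = λ () ; v≢w = λ ()
  ; G-b-connected = λ x≢s → Conn-trans (to-t x≢s) (Conn-sym (to-t λ ()))
  }
  where
  open R21Structure (R21Base.structure post)
  open R21Base post using (N[s₁])
  G = graphOf (R21 [] post)
  to-t = without-s-reaches-t (sp-reach-terminals (R21 [] post) wf)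

-- Separating vertices

record Separation {m} (E : TwoTerminal m) (u : Fin (2 + m)) : Set where
  field
    u-Inner          : Inner u
    colour           : Fin (2 + m) → Bool
    colour-s         : colour zero ≡ false
    colour-t         : colour (suc zero) ≡ true
    colour-invariant : EdgeInvariant (net E) ⁅ u ⁆ colour

  s-t-disconnected : ¬ Conn (net E) ⁅ u ⁆ zero (suc zero)
  s-t-disconnected p with () ← trans (sym colour-s) (trans (Conn-invariant colour-invariant p) colour-t)

-- false on the left part, f on the right part (junction included) of a series join
serColour : ∀ m₁ {m₂} → (Fin (2 + m₂) → Bool) → Fin (2 + joinSize ser m₁ m₂) → Bool
serColour m₁ f zero                = false
serColour m₁ f (suc zero)          = f (suc zero)
serColour m₁ f (suc (suc zero))    = f zero
serColour m₁ f (suc (suc (suc i))) = Data.Sum.[ (λ _ → false) , (λ b → f (suc (suc b))) ] (splitAt m₁ i)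

module _ {m₁ m₂ : ℕ} (f : Fin (2 + m₂) → Bool) where

  serColour-L : ∀ {y} → y ≢ suc zero ⊎ f zero ≡ false → serColour m₁ f (joinL ser m₁ m₂ y) ≡ false
  serColour-L {zero}        _            = refl
  serColour-L {suc zero}    (inj₁ y≢t)   = ⊥-elim (y≢t refl)
  serColour-L {suc zero}    (inj₂ f-s≡f) = f-s≡f
  serColour-L {suc (suc a)} _ rewrite Finₚ.splitAt-↑ˡ m₁ a m₂ = refl

  serColour-R : ∀ z → serColour m₁ f (joinR ser m₁ m₂ z) ≡ f z
  serColour-R zero          = refl
  serColour-R (suc zero)    = refl
  serColour-R (suc (suc b)) rewrite Finₚ.splitAt-↑ʳ m₁ m₂ b = refl

series-separation : ∀ {m₁ m₂} {E₁ : TwoTerminal m₁} {E₂ : TwoTerminal m₂} {u} (f : Fin (2 + m₂) → Bool) →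
  f (suc zero) ≡ true → EdgeInvariant (net E₂) ⁅ u ⁆ f → u ≡ zero ⊎ (Inner u × f zero ≡ false) →
  Separation (joinEdges ser E₁ E₂) (joinR ser m₁ m₂ u)
series-separation {m₁} {m₂} {E₁} {E₂} {u} f f-t f-inv u-s-or-inner = record
  { u-Inner = u-Inner ; colour = serColour m₁ f ; colour-s = refl ; colour-t = f-t ; colour-invariant = invariant }
  where
  u-Inner : Inner (joinR ser m₁ m₂ u)
  u-Inner = Data.Sum.[ (λ u≡s → subst (Inner ∘ joinR ser m₁ m₂) (sym u≡s) tt) , joinR-Inner ser ∘ proj₁ ] u-s-or-inner
  left-false : ∀ {y} → joinL ser m₁ m₂ y ∉ ⁅ joinR ser m₁ m₂ u ⁆ → serColour m₁ f (joinL ser m₁ m₂ y) ≡ false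
  left-false {y} y∉ = serColour-L f (Data.Sum.map y≢t proj₂ u-s-or-inner)
    where
    y≢t : u ≡ zero → y ≢ suc zero
    y≢t refl refl = y∉ (Subsetₚ.x∈⁅x⁆ _)
  invariant : EdgeInvariant (net (joinEdges ser E₁ E₂)) ⁅ joinR ser m₁ m₂ u ⁆ (serColour m₁ f)
  invariant x∉ y∉ xy with Adj-join⁻ ser E₁ E₂ xy
  ... | inj₁ (x′ , y′ , _ , refl , refl) = trans (left-false x∉) (sym (left-false y∉))
  ... | inj₂ (x′ , y′ , x′y′ , refl , refl) = trans (serColour-R f x′) (trans
        (f-inv (∉⁅⁆-preimage {f = joinR ser m₁ m₂} x∉) (∉⁅⁆-preimage {f = joinR ser m₁ m₂} y∉) x′y′)
        (sym (serColour-R f y′)))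

junction-Separation : ∀ {m₁ m₂} (E₁ : TwoTerminal m₁) (E₂ : TwoTerminal m₂) →
                      Separation (joinEdges ser E₁ E₂) (joinR ser m₁ m₂ zero)
junction-Separation E₁ E₂ = series-separation {E₁ = E₁} {E₂ = E₂} (λ _ → true) refl (λ _ _ _ → refl) (inj₁ refl)

series-child-s-Separation : ∀ c cs i → Separation (edgesList ser (c ∷ cs)) (childEmb ser (c ∷ cs) (suc i) zero)
series-child-s-Separation c (c′ ∷ [])      zero    = junction-Separation (edgesOf c) (edgesOf c′)
series-child-s-Separation c (c′ ∷ c″ ∷ cs) zero    = junction-Separation (edgesOf c) (edgesList ser (c′ ∷ c″ ∷ cs))
series-child-s-Separation c (c′ ∷ c″ ∷ cs) (suc i) =
  series-separation {E₁ = edgesOf c} colour colour-t colour-invariant (inj₂ (u-Inner , colour-s))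
  where open Separation (series-child-s-Separation c′ (c″ ∷ cs) i)

Separation⇒CutVertex : ∀ T → WF T → ∀ {u} → Separation (edgesOf T) u → CutVertex (graphOf T) u
Separation⇒CutVertex T wf {u} sep = 1 , 2 , whole , split , ℕ.s≤s (ℕ.s≤s ℕ.z≤n)
  where
  open Separation sep
  whole : Components (graphOf T) ∅ 1
  whole = (λ _ → zero) , (λ _ → Subsetₚ.∉⊥) , (λ { zero zero _ → refl }) , λ x _ → zero , sp-connected T wf x

  terminal : Fin 2 → Fin (2 + inner T)
  terminal i = i ↑ˡ inner T

  terminal∉ : ∀ i → terminal i ∉ ⁅ u ⁆
  terminal∉ zero       = Subsetₚ.x≢y⇒x∉⁅y⁆ (Inner⇒≢s u-Inner ∘ sym)
  terminal∉ (suc zero) = Subsetₚ.x≢y⇒x∉⁅y⁆ (Inner⇒≢t u-Inner ∘ sym)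

  distinct : ∀ i j → Conn (graphOf T) ⁅ u ⁆ (terminal i) (terminal j) → i ≡ j
  distinct zero       zero       _ = refl
  distinct zero       (suc zero) p = ⊥-elim (s-t-disconnected p)
  distinct (suc zero) zero       p = ⊥-elim (s-t-disconnected (Conn-sym p))
  distinct (suc zero) (suc zero) _ = refl

  reaches : ∀ x → x ∉ ⁅ u ⁆ → Σ (Fin 2) λ i → Conn (graphOf T) ⁅ u ⁆ x (terminal i)
  reaches x x∉ with sp-reach-terminals T wf (Subsetₚ.x∉⁅y⁆⇒x≢y x∉)
  ... | inj₁ to-s = zero , to-s
  ... | inj₂ to-t = suc zero , to-t

  split : Components (graphOf T) ⁅ u ⁆ 2
  split = terminal , terminal∉ , distinct , reaches

lemma4p11 : (T : SPT) → WF T → MinimallyTough (graphOf T) ½ →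
            (p : Pos T) (pre post : List SPT) →
            (eq : subAt T p ≡ node ser (R21Children pre post)) →
            (p ≡ root) × CutVertex (graphOf T) (s₁At T p pre post eq)
lemma4p11 T wf minimal root [] post refl =
  ⊥-elim (¬minimally-½-tough (first-R21-RemovableEdge post wf) minimal)
lemma4p11 T wf minimal root (c ∷ pre) post refl =
  refl , Separation⇒CutVertex T wf (series-child-s-Separation c (pre ++ R₂ ∷ leaf ∷ post) (r2Index pre post))
lemma4p11 T wf minimal p@(child _ _) pre post eq =
  ⊥-elim (¬minimally-½-tough (nonroot-R21-RemovableEdge T p tt wf pre post eq) minimal)
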